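{- Write $a_n(x)=\sum_{k=0}^n b(n,k)(x-1)^k$, with $b(x,y)=0$ if $y>x$. Then for all $n,k\ge1$, $$b(n,k)=\sum_{i=1}^n C_{i-1}\,b(n-i,k-1).$$
   Context: For $n\ge0$, $a_n(x)=\sum_{\pi\in S_n(321)}x^{f(\pi)}$, where $S_n(321)$ is the set of permutations $\pi=\pi_1\cdots\pi_n$ of $\{1,\dots,n\}$ with no indices $i<j<l$ such that $\pi_i>\pi_j>\pi_l$, and $f(\pi)$ is the number of indices $i$ with $\pi_i=i$ ($a_0(x)=1$). $C_m=\frac1{m+1}\binom{2m}{m}$ is the $m$-th Catalan number. (One has $b(m,0)=C_m$.) -}

module Defs where

open import Data.Bool using (Bool; true; false; not; _∧_; if_then_else_)
open import Data.Nat as ℕ using (ℕ; zero; suc; _<ᵇ_; _≡ᵇ_)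
open import Data.Nat.Combinatorics using (_C_)
open import Data.Nat.DivMod using (_/_)
open import Data.Fin using (Fin; toℕ)
open import Data.Vec using (Vec; []; _∷_; lookup)
open import Data.List using (List; []; _∷_; [_]; map; concatMap; filter; allFin; upTo; length; foldr)
open import Data.Bool.ListAction using (any; all)
open import Data.Integer as ℤ using (ℤ; _+_; _-_; _*_; _^_; +_)
import Data.Integer as Z

allVec : (m n : ℕ) → List (Vec (Fin m) n)
allVec m zero = [ [] ]
allVec m (suc n) = concatMap (λ i → map (i ∷_) (allVec m n)) (allFin m)

-- a word w : Vec (Fin n) n is a permutation iff it is injective
-- (positions and values are 0-based: position i stands for i+1, value v for v+1)
isPerm : ∀ {n} → Vec (Fin n) n → Bool
isPerm {n} w = all (λ i → all (λ j →
  not ((toℕ i <ᵇ toℕ j) ∧ (toℕ (lookup w i) ≡ᵇ toℕ (lookup w j)))) (allFin n)) (allFin n)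

has321 : ∀ {n} → Vec (Fin n) n → Bool
has321 {n} w = any (λ i → any (λ j → any (λ l →
  (toℕ i <ᵇ toℕ j) ∧ (toℕ j <ᵇ toℕ l) ∧
  (toℕ (lookup w j) <ᵇ toℕ (lookup w i)) ∧ (toℕ (lookup w l) <ᵇ toℕ (lookup w j)))
  (allFin n)) (allFin n)) (allFin n)

S321 : (n : ℕ) → List (Vec (Fin n) n)
S321 n = filter (λ w → Data.Bool._≟_ (isPerm w ∧ not (has321 w)) true) (allVec n n)
  where import Data.Bool

fixedPoints : ∀ {n} → Vec (Fin n) n → ℕ
fixedPoints {n} w = length (filter (λ i → toℕ (lookup w i) Data.Nat.≟ toℕ i) (allFin n))
  where import Data.Nat

ΣZ : List ℤ → ℤ
ΣZ = foldr _+_ (+ 0)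

a : ℕ → ℤ → ℤ
a n x = ΣZ (map (λ w → x ^ fixedPoints w) (S321 n))

catalan : ℕ → ℕ
catalan m = ((2 ℕ.* m) C m) / suc m

-- If π ∈ S_n(321) fixes m, its entries before m are smaller than m and those after m are larger,
-- so π = σ ⊕ 1 ⊕ τ with σ ∈ S_m(321) and τ ∈ S_(n-1-m)(321). Expanding
-- x^f(π) = 1 + (x - 1) Σ_i x^(number of fixed points after the i-th one) and summing over π gives
-- a_n(x) = C_n + (x - 1) Σ_(m<n) C_m a_(n-1-m)(x). Here |S_n(321)| = C_n comes from the generating
-- tree that inserts the new maximum into the final increasing run; its level sizes are ballot
-- numbers. With x = y + 1 both sides are polynomials in y agreeing at all positive integers, and
-- comparing the coefficients of y^k gives the recurrence for b(n, k).
module Submission where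

module IntegerListSum where

  open import Defs using (ΣZ)
  open import Level using (Level)
  open import Function using (_∘_)
  open import Data.Bool using (if_then_else_)
  open import Data.Integer using (ℤ; _+_; _*_; 0ℤ; 1ℤ)
  open import Data.Integer.Properties
  open import Data.List using (List; []; _∷_; map; _++_; concatMap; filter)
  open import Data.List.Membership.Propositional using (_∈_)
  open import Data.List.Relation.Unary.Any using (here; there)
  open import Data.List.Relation.Binary.Permutation.Propositional using (_↭_; refl; prep; swap; trans)
  open import Relation.Nullary using (yes; no; does)
  open import Relation.Unary using (Pred; Decidable)
  open import Relation.Binary.PropositionalEquality as ≡ using (_≡_; sym; cong; cong₂)
  open ≡.≡-Reasoning

  private variable
    a : Level
    A B : Set a

  ΣZ-++ : (f : A → ℤ) (xs ys : List A) → ΣZ (map f (xs ++ ys)) ≡ ΣZ (map f xs) + ΣZ (map f ys)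
  ΣZ-++ f [] ys = sym (+-identityˡ _)
  ΣZ-++ f (x ∷ xs) ys = ≡.trans (cong (f x +_) (ΣZ-++ f xs ys)) (sym (+-assoc (f x) _ _))

  ΣZ-↭ : (f : A → ℤ) {xs ys : List A} → xs ↭ ys → ΣZ (map f xs) ≡ ΣZ (map f ys)
  ΣZ-↭ f refl = ≡.refl
  ΣZ-↭ f (prep x p) = cong (f x +_) (ΣZ-↭ f p)
  ΣZ-↭ f (swap {xs} {ys} x y p) = begin
    f x + (f y + ΣZ (map f xs)) ≡⟨ sym (+-assoc (f x) (f y) _) ⟩
    (f x + f y) + ΣZ (map f xs) ≡⟨ cong₂ _+_ (+-comm (f x) (f y)) (ΣZ-↭ f p) ⟩
    (f y + f x) + ΣZ (map f ys) ≡⟨ +-assoc (f y) (f x) _ ⟩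
    f y + (f x + ΣZ (map f ys)) ∎
  ΣZ-↭ f (trans p q) = ≡.trans (ΣZ-↭ f p) (ΣZ-↭ f q)

  ΣZ-map : (f : B → ℤ) (g : A → B) (xs : List A) → ΣZ (map f (map g xs)) ≡ ΣZ (map (f ∘ g) xs)
  ΣZ-map f g [] = ≡.refl
  ΣZ-map f g (x ∷ xs) = cong (f (g x) +_) (ΣZ-map f g xs)

  ΣZ-cong : {f g : A → ℤ} (xs : List A) → (∀ x → x ∈ xs → f x ≡ g x) → ΣZ (map f xs) ≡ ΣZ (map g xs)
  ΣZ-cong [] h = ≡.refl
  ΣZ-cong (x ∷ xs) h = cong₂ _+_ (h x (here ≡.refl)) (ΣZ-cong xs (λ y m → h y (there m)))

  ΣZ-concatMap : (f : B → ℤ) (g : A → List B) (xs : List A) →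
    ΣZ (map f (concatMap g xs)) ≡ ΣZ (map (λ x → ΣZ (map f (g x))) xs)
  ΣZ-concatMap f g [] = ≡.refl
  ΣZ-concatMap f g (x ∷ xs) =
    ≡.trans (ΣZ-++ f (g x) (concatMap g xs)) (cong (ΣZ (map f (g x)) +_) (ΣZ-concatMap f g xs))

  ΣZ-zero : (xs : List A) → ΣZ (map (λ _ → 0ℤ) xs) ≡ 0ℤ
  ΣZ-zero [] = ≡.refl
  ΣZ-zero (x ∷ xs) = ≡.trans (+-identityˡ _) (ΣZ-zero xs)

  ΣZ-+ : (f g : A → ℤ) (xs : List A) → ΣZ (map (λ x → f x + g x) xs) ≡ ΣZ (map f xs) + ΣZ (map g xs)
  ΣZ-+ f g [] = ≡.refl
  ΣZ-+ f g (x ∷ xs) = begin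
    (f x + g x) + ΣZ (map (λ x → f x + g x) xs) ≡⟨ cong ((f x + g x) +_) (ΣZ-+ f g xs) ⟩
    (f x + g x) + (ΣZ (map f xs) + ΣZ (map g xs)) ≡⟨ +-assoc (f x) (g x) _ ⟩
    f x + (g x + (ΣZ (map f xs) + ΣZ (map g xs))) ≡⟨ cong (f x +_) (+-left-comm (g x) (ΣZ (map f xs)) (ΣZ (map g xs))) ⟩
    f x + (ΣZ (map f xs) + (g x + ΣZ (map g xs))) ≡⟨ sym (+-assoc (f x) (ΣZ (map f xs)) _) ⟩
    (f x + ΣZ (map f xs)) + (g x + ΣZ (map g xs)) ∎
    where +-left-comm : ∀ a b c → a + (b + c) ≡ b + (a + c)
          +-left-comm a b c = ≡.trans (sym (+-assoc a b c)) (≡.trans (cong (_+ c) (+-comm a b)) (+-assoc b a c))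

  ΣZ-*ˡ : (c : ℤ) (f : A → ℤ) (xs : List A) → c * ΣZ (map f xs) ≡ ΣZ (map (λ x → c * f x) xs)
  ΣZ-*ˡ c f [] = *-zeroʳ c
  ΣZ-*ˡ c f (x ∷ xs) = ≡.trans (*-distribˡ-+ c (f x) _) (cong (c * f x +_) (ΣZ-*ˡ c f xs))

  ΣZ-const : (c : ℤ) (xs : List A) → ΣZ (map (λ _ → c) xs) ≡ ΣZ (map (λ _ → 1ℤ) xs) * c
  ΣZ-const c [] = sym (*-zeroˡ c)
  ΣZ-const c (x ∷ xs) = begin
    c + ΣZ (map (λ _ → c) xs)              ≡⟨ cong₂ _+_ (sym (*-identityˡ c)) (ΣZ-const c xs) ⟩
    1ℤ * c + ΣZ (map (λ _ → 1ℤ) xs) * c    ≡⟨ sym (*-distribʳ-+ c 1ℤ (ΣZ (map (λ _ → 1ℤ) xs))) ⟩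
    (1ℤ + ΣZ (map (λ _ → 1ℤ) xs)) * c      ∎

  ΣZ-filter : {P : Pred A a} (P? : Decidable P) (f : A → ℤ) (xs : List A) →
    ΣZ (map f (filter P? xs)) ≡ ΣZ (map (λ x → if does (P? x) then f x else 0ℤ) xs)
  ΣZ-filter P? f [] = ≡.refl
  ΣZ-filter P? f (x ∷ xs) with P? x
  ... | yes _ = cong (f x +_) (ΣZ-filter P? f xs)
  ... | no _ = ≡.trans (ΣZ-filter P? f xs) (sym (+-identityˡ _))


module UniqueList where

  open import Level using (Level)
  open import Function.Bundles using (mk⇔)
  open import Data.Product using (_,_)
  open import Data.List using (List; []; _∷_; map; concatMap)
  open import Data.List.Membership.Propositional using (_∈_)
  open import Data.List.Membership.Propositional.Properties using (∈-concatMap⁻)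
  open import Data.List.Relation.Unary.Any using (Any; here; there)
  open import Data.List.Relation.Unary.All as All using (All)
  import Data.List.Relation.Unary.All.Properties as All
  open import Data.List.Relation.Unary.AllPairs using ([]; _∷_)
  open import Data.List.Relation.Unary.Unique.Propositional using (Unique)
  import Data.List.Relation.Unary.Unique.Propositional.Properties as Unique
  open import Data.List.Relation.Binary.Permutation.Propositional using (_↭_)
  open import Data.List.Membership.Propositional.Properties.WithK using (unique∧set⇒bag)
  open import Data.List.Relation.Binary.BagAndSetEquality using (∼bag⇒↭)
  open import Relation.Binary.PropositionalEquality using (_≡_; _≢_; refl)
  open import Data.Empty using (⊥)

  private variable
    a : Level
    A B : Set a

  unique-↭ : {xs ys : List A} → Unique xs → Unique ys →
    (∀ {z} → z ∈ xs → z ∈ ys) → (∀ {z} → z ∈ ys → z ∈ xs) → xs ↭ ys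
  unique-↭ ux uy f g = ∼bag⇒↭ (unique∧set⇒bag ux uy (mk⇔ f g))

  Unique-map : (f : A → B) (xs : List A) →
    (∀ x y → x ∈ xs → y ∈ xs → f x ≡ f y → x ≡ y) → Unique xs → Unique (map f xs)
  Unique-map f [] _ _ = []
  Unique-map f (x ∷ xs) f-inj (x∉ ∷ u) =
    All.map⁺ (All.tabulate (λ y∈ fx≡fy → All.lookup x∉ y∈ (f-inj _ _ (here refl) (there y∈) fx≡fy)))
    ∷ Unique-map f xs (λ y z y∈ z∈ → f-inj y z (there y∈) (there z∈)) u

  Unique-concatMap : (f : A → List B) (xs : List A) → Unique xs → (∀ x → x ∈ xs → Unique (f x)) →
    (∀ x y z → x ∈ xs → y ∈ xs → z ∈ f x → z ∈ f y → x ≡ y) → Unique (concatMap f xs)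
  Unique-concatMap f [] u uf disjoint = []
  Unique-concatMap f (x ∷ xs) (x∉ ∷ u) uf disjoint =
    Unique.++⁺ (uf x (here refl))
      (Unique-concatMap f xs u (λ y y∈ → uf y (there y∈)) (λ y y′ z y∈ y′∈ → disjoint y y′ z (there y∈) (there y′∈)))
      (λ (z∈fx , z∈rest) → apart xs x∉ (λ y∈ → y∈) z∈fx (∈-concatMap⁻ f {xs = xs} z∈rest))
    where
    apart : ∀ {z} ys → All (x ≢_) ys → (∀ {y} → y ∈ ys → y ∈ xs) → z ∈ f x → Any (λ y → z ∈ f y) ys → ⊥
    apart (y ∷ ys) (x≢y All.∷ _) sub z∈fx (here z∈fy) =
      x≢y (disjoint x y _ (here refl) (there (sub (here refl))) z∈fx z∈fy)
    apart (y ∷ ys) (_ All.∷ x∉ys) sub z∈fx (there z∈) = apart ys x∉ys (λ y∈ → sub (there y∈)) z∈fx z∈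


module RangeSum where

  open import Defs using (ΣZ)
  open import Function using (_∘_; id)
  open import Data.Nat as ℕ using (ℕ; zero; suc; _<_; s≤s; _∸_)
  import Data.Nat.Properties as ℕ
  open import Data.Integer using (ℤ; _+_; _-_; _*_; 0ℤ)
  open import Data.Integer.Properties
  open import Data.Integer.Tactic.RingSolver using (solve-∀)
  open import Data.List using (List; map; upTo; applyUpTo)
  open import Relation.Binary.PropositionalEquality as ≡ using (_≡_; sym; cong; cong₂)
  open IntegerListSum
  open ≡.≡-Reasoning

  Σ< : ℕ → (ℕ → ℤ) → ℤ
  Σ< zero f = 0ℤ
  Σ< (suc m) f = Σ< m f + f m

  Σ<-sucˡ : ∀ m f → Σ< (suc m) f ≡ f 0 + Σ< m (f ∘ suc)
  Σ<-sucˡ zero f = ≡.trans (+-identityˡ (f 0)) (sym (+-identityʳ (f 0)))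
  Σ<-sucˡ (suc m) f = begin
    Σ< (suc m) f + f (suc m)            ≡⟨ cong (_+ f (suc m)) (Σ<-sucˡ m f) ⟩
    (f 0 + Σ< m (f ∘ suc)) + f (suc m)  ≡⟨ +-assoc (f 0) _ _ ⟩
    f 0 + Σ< (suc m) (f ∘ suc)          ∎

  Σ<-cong : ∀ m {f g : ℕ → ℤ} → (∀ i → i < m → f i ≡ g i) → Σ< m f ≡ Σ< m g
  Σ<-cong zero h = ≡.refl
  Σ<-cong (suc m) h = cong₂ _+_ (Σ<-cong m (λ i i< → h i (ℕ.m<n⇒m<1+n i<))) (h m (ℕ.n<1+n m))

  Σ<-zero : ∀ m (f : ℕ → ℤ) → (∀ i → i < m → f i ≡ 0ℤ) → Σ< m f ≡ 0ℤ
  Σ<-zero m f h = ≡.trans (Σ<-cong m h) (zeros m)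
    where zeros : ∀ m → Σ< m (λ _ → 0ℤ) ≡ 0ℤ
          zeros zero = ≡.refl
          zeros (suc m) = cong (_+ 0ℤ) (zeros m)

  Σ<-reverse : ∀ m f → Σ< m (λ i → f (m ∸ suc i)) ≡ Σ< m f
  Σ<-reverse zero f = ≡.refl
  Σ<-reverse (suc m) f = begin
    Σ< (suc m) (λ i → f (suc m ∸ suc i)) ≡⟨ Σ<-sucˡ m _ ⟩
    f m + Σ< m (λ i → f (m ∸ suc i))     ≡⟨ cong (f m +_) (Σ<-reverse m f) ⟩
    f m + Σ< m f                         ≡⟨ +-comm (f m) _ ⟩
    Σ< (suc m) f                         ∎

  Σ<-trailingZeros : ∀ m d (f : ℕ → ℤ) → (∀ i → m < i → f i ≡ 0ℤ) → Σ< (suc m ℕ.+ d) f ≡ Σ< (suc m) f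
  Σ<-trailingZeros m zero f h = cong (λ l → Σ< l f) (ℕ.+-identityʳ (suc m))
  Σ<-trailingZeros m (suc d) f h = begin
    Σ< (suc m ℕ.+ suc d) f                    ≡⟨ cong (λ l → Σ< l f) (ℕ.+-suc (suc m) d) ⟩
    Σ< (suc m ℕ.+ d) f + f (suc m ℕ.+ d)      ≡⟨ cong₂ _+_ (Σ<-trailingZeros m d f h) (h _ (s≤s (ℕ.m≤m+n m d))) ⟩
    Σ< (suc m) f + 0ℤ                         ≡⟨ +-identityʳ _ ⟩
    Σ< (suc m) f                              ∎

  Σ<-distrib-+ : ∀ m (f g : ℕ → ℤ) → Σ< m (λ i → f i + g i) ≡ Σ< m f + Σ< m g
  Σ<-distrib-+ zero f g = ≡.refl
  Σ<-distrib-+ (suc m) f g =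
    ≡.trans (cong (_+ (f m + g m)) (Σ<-distrib-+ m f g)) (middleFour (Σ< m f) (Σ< m g) (f m) (g m))
    where middleFour : ∀ a b c d → (a + b) + (c + d) ≡ (a + c) + (b + d)
          middleFour = solve-∀

  Σ<-distrib-- : ∀ m (f g : ℕ → ℤ) → Σ< m (λ i → f i - g i) ≡ Σ< m f - Σ< m g
  Σ<-distrib-- zero f g = ≡.refl
  Σ<-distrib-- (suc m) f g =
    ≡.trans (cong (_+ (f m - g m)) (Σ<-distrib-- m f g)) (middleFour (Σ< m f) (Σ< m g) (f m) (g m))
    where middleFour : ∀ a b c d → (a - b) + (c - d) ≡ (a + c) - (b + d)
          middleFour = solve-∀

  Σ<-*ˡ : ∀ m c (f : ℕ → ℤ) → c * Σ< m f ≡ Σ< m (λ i → c * f i)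
  Σ<-*ˡ zero c f = *-zeroʳ c
  Σ<-*ˡ (suc m) c f = ≡.trans (*-distribˡ-+ c (Σ< m f) (f m)) (cong (_+ c * f m) (Σ<-*ˡ m c f))

  Σ<-*ʳ : ∀ m (f : ℕ → ℤ) c → Σ< m f * c ≡ Σ< m (λ i → f i * c)
  Σ<-*ʳ m f c = ≡.trans (*-comm (Σ< m f) c) (≡.trans (Σ<-*ˡ m c f) (Σ<-cong m (λ i _ → *-comm c (f i))))

  Σ<-swap : ∀ m l (f : ℕ → ℕ → ℤ) → Σ< m (λ i → Σ< l (f i)) ≡ Σ< l (λ j → Σ< m (λ i → f i j))
  Σ<-swap zero l f = sym (Σ<-zero l (λ _ → 0ℤ) (λ _ _ → ≡.refl))
  Σ<-swap (suc m) l f =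
    ≡.trans (cong (_+ Σ< l (f m)) (Σ<-swap m l f)) (sym (Σ<-distrib-+ l (λ j → Σ< m (λ i → f i j)) (f m)))

  Σ<-collect : ∀ m l (c : ℕ → ℤ) (f : ℕ → ℕ → ℤ) (g : ℕ → ℤ) →
    Σ< m (λ j → c j * Σ< l (λ i → f j i * g i)) ≡ Σ< l (λ i → Σ< m (λ j → c j * f j i) * g i)
  Σ<-collect m l c f g = begin
    Σ< m (λ j → c j * Σ< l (λ i → f j i * g i))
      ≡⟨ Σ<-cong m (λ j _ → Σ<-*ˡ l (c j) _) ⟩
    Σ< m (λ j → Σ< l (λ i → c j * (f j i * g i)))
      ≡⟨ Σ<-swap m l _ ⟩
    Σ< l (λ i → Σ< m (λ j → c j * (f j i * g i)))
      ≡⟨ Σ<-cong l (λ i _ → Σ<-cong m (λ j _ → sym (*-assoc (c j) (f j i) (g i)))) ⟩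
    Σ< l (λ i → Σ< m (λ j → c j * f j i * g i))
      ≡⟨ Σ<-cong l (λ i _ → sym (Σ<-*ʳ m _ (g i))) ⟩
    Σ< l (λ i → Σ< m (λ j → c j * f j i) * g i) ∎

  ΣZ-Σ< : {A : Set} (f : A → ℕ → ℤ) (xs : List A) (m : ℕ) →
    ΣZ (map (λ x → Σ< m (f x)) xs) ≡ Σ< m (λ i → ΣZ (map (λ x → f x i) xs))
  ΣZ-Σ< f xs zero = ΣZ-zero xs
  ΣZ-Σ< f xs (suc m) =
    ≡.trans (ΣZ-+ (λ x → Σ< m (f x)) (λ x → f x m) xs) (cong (_+ ΣZ (map (λ x → f x m) xs)) (ΣZ-Σ< f xs m))

  ΣZ-applyUpTo : ∀ (f : ℕ → ℤ) (g : ℕ → ℕ) m → ΣZ (map f (applyUpTo g m)) ≡ Σ< m (f ∘ g)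
  ΣZ-applyUpTo f g zero = ≡.refl
  ΣZ-applyUpTo f g (suc m) = ≡.trans (cong (f (g 0) +_) (ΣZ-applyUpTo f (g ∘ suc) m)) (sym (Σ<-sucˡ m (f ∘ g)))

  ΣZ-upTo : ∀ (f : ℕ → ℤ) m → ΣZ (map f (upTo m)) ≡ Σ< m f
  ΣZ-upTo f m = ΣZ-applyUpTo f id m


module PolynomialCoefficients where

  open import Function using (_∘_)
  open import Data.Nat as ℕ using (ℕ; zero; suc; _<_; s≤s)
  import Data.Nat.Properties as ℕ
  open import Data.Integer using (ℤ; +_; _+_; _-_; -_; _*_; _^_; ∣_∣; 0ℤ; 1ℤ)
  open import Data.Integer.Properties
  open import Data.Integer.Tactic.RingSolver using (solve-∀)
  open import Data.Empty using (⊥-elim)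
  open import Relation.Binary.PropositionalEquality as ≡ using (_≡_; sym; cong; cong₂)
  open RangeSum
  open ≡.≡-Reasoning

  n≡[1+n]*q⇒n≡0 : ∀ n q → n ≡ suc n ℕ.* q → n ≡ 0
  n≡[1+n]*q⇒n≡0 n zero e = ≡.trans e (ℕ.*-zeroʳ (suc n))
  n≡[1+n]*q⇒n≡0 n (suc q) e = ⊥-elim (ℕ.<-irrefl e (ℕ.<-≤-trans (ℕ.n<1+n n) (ℕ.m≤m*n (suc n) (suc q))))

  horner : ∀ N (d : ℕ → ℤ) y → Σ< (suc N) (λ k → d k * y ^ k) ≡ d 0 + y * Σ< N (λ k → d (suc k) * y ^ k)
  horner N d y = begin
    Σ< (suc N) (λ k → d k * y ^ k)
      ≡⟨ Σ<-sucˡ N _ ⟩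
    d 0 * 1ℤ + Σ< N (λ k → d (suc k) * (y * y ^ k))
      ≡⟨ cong₂ _+_ (*-identityʳ (d 0)) (Σ<-cong N (λ k _ → shift (d (suc k)) y (y ^ k))) ⟩
    d 0 + Σ< N (λ k → y * (d (suc k) * y ^ k))
      ≡⟨ cong (_+_ (d 0)) (sym (Σ<-*ˡ N y _)) ⟩
    d 0 + y * Σ< N (λ k → d (suc k) * y ^ k) ∎
    where
    shift : ∀ a y p → a * (y * p) ≡ y * (a * p)
    shift = solve-∀

  vanishing⇒coefficients≡0 : ∀ N (d : ℕ → ℤ) → (∀ t → Σ< N (λ k → d k * (+ suc t) ^ k) ≡ 0ℤ) →
                             ∀ k → k < N → d k ≡ 0ℤ
  vanishing⇒coefficients≡0 (suc N) d vanishing = coefficient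
    where
    Q : ℤ → ℤ
    Q y = Σ< N (λ k → d (suc k) * y ^ k)

    root : ∀ t → d 0 + + suc t * Q (+ suc t) ≡ 0ℤ
    root t = ≡.trans (sym (horner N d (+ suc t))) (vanishing t)

    d0≡-yQ : ∀ t → d 0 ≡ - (+ suc t * Q (+ suc t))
    d0≡-yQ t = ≡.trans (cancel (d 0) _) (≡.trans (cong (_- (+ suc t * Q (+ suc t))) (root t)) (+-identityˡ _))
      where cancel : ∀ a b → a ≡ (a + b) - b
            cancel = solve-∀

    -- Evaluating at 1 + ∣ d 0 ∣ shows that ∣ d 0 ∣ is a multiple of 1 + ∣ d 0 ∣.
    d0≡0 : d 0 ≡ 0ℤ
    d0≡0 = ∣i∣≡0⇒i≡0 (n≡[1+n]*q⇒n≡0 ∣ d 0 ∣ ∣ Q y ∣ (begin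
      ∣ d 0 ∣              ≡⟨ cong ∣_∣ (d0≡-yQ ∣ d 0 ∣) ⟩
      ∣ - (y * Q y) ∣      ≡⟨ ∣-i∣≡∣i∣ (y * Q y) ⟩
      ∣ y * Q y ∣          ≡⟨ abs-* y (Q y) ⟩
      suc ∣ d 0 ∣ ℕ.* ∣ Q y ∣ ∎))
      where y = + suc ∣ d 0 ∣

    Q-vanishing : ∀ t → Q (+ suc t) ≡ 0ℤ
    Q-vanishing t = *-cancelˡ-≡ (+ suc t) (Q (+ suc t)) 0ℤ (begin
      + suc t * Q (+ suc t)        ≡⟨ sym (+-identityˡ _) ⟩
      0ℤ + + suc t * Q (+ suc t)   ≡⟨ cong (_+ (+ suc t * Q (+ suc t))) (sym d0≡0) ⟩
      d 0 + + suc t * Q (+ suc t)  ≡⟨ root t ⟩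
      0ℤ                           ≡⟨ sym (*-zeroʳ (+ suc t)) ⟩
      + suc t * 0ℤ                 ∎)

    coefficient : ∀ k → k < suc N → d k ≡ 0ℤ
    coefficient zero _ = d0≡0
    coefficient (suc k) (s≤s k<N) = vanishing⇒coefficients≡0 N (d ∘ suc) Q-vanishing k k<N

  coefficients-unique : ∀ N (e f : ℕ → ℤ) →
    (∀ y → Σ< N (λ k → e k * y ^ k) ≡ Σ< N (λ k → f k * y ^ k)) → ∀ k → k < N → e k ≡ f k
  coefficients-unique N e f same k k<N = begin
    e k                ≡⟨ split (e k) (f k) ⟩
    (e k - f k) + f k  ≡⟨ cong (_+ f k) (vanishing⇒coefficients≡0 N (λ k → e k - f k) difference k k<N) ⟩
    0ℤ + f k           ≡⟨ +-identityˡ (f k) ⟩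
    f k                ∎
    where
    split : ∀ a b → a ≡ (a - b) + b
    split = solve-∀
    distrib : ∀ a b p → (a - b) * p ≡ a * p - b * p
    distrib = solve-∀
    difference : ∀ t → Σ< N (λ k → (e k - f k) * (+ suc t) ^ k) ≡ 0ℤ
    difference t = begin
      Σ< N (λ k → (e k - f k) * y ^ k)                         ≡⟨ Σ<-cong N (λ k _ → distrib (e k) (f k) (y ^ k)) ⟩
      Σ< N (λ k → e k * y ^ k - f k * y ^ k)                   ≡⟨ Σ<-distrib-- N _ _ ⟩
      Σ< N (λ k → e k * y ^ k) - Σ< N (λ k → f k * y ^ k)      ≡⟨ cong (_- Σ< N (λ k → f k * y ^ k)) (same y) ⟩
      Σ< N (λ k → f k * y ^ k) - Σ< N (λ k → f k * y ^ k)      ≡⟨ +-inverseʳ (Σ< N (λ k → f k * y ^ k)) ⟩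
      0ℤ                                                       ∎
      where y = + suc t


module Ballot where

  open import Defs using (catalan)
  open import Data.Nat as ℕ using (ℕ; zero; suc; _≤_; z≤n; s≤s; _∸_)
  import Data.Nat.Properties as ℕ
  import Data.Nat.Tactic.RingSolver as ℕ-Solver
  open import Data.Nat.Combinatorics using (_C_; nCk+nC[k+1]≡[n+1]C[k+1]; k>n⇒nCk≡0; nCk≡nC[n∸k]; nC1≡n)
  open import Data.Nat.DivMod using (_/_; m*n/n≡m)
  open import Data.Integer using (ℤ; +_; _+_; _*_; _-_; 1ℤ)
  open import Data.Integer.Properties
  open import Data.Integer.Tactic.RingSolver using (solve-∀)
  open import Relation.Binary.PropositionalEquality as ≡ using (_≡_; refl; sym; trans; cong; cong₂; subst)
  open RangeSum using (Σ<)
  open ≡.≡-Reasoning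

  Σℕ< : ℕ → (ℕ → ℕ) → ℕ
  Σℕ< zero f = 0
  Σℕ< (suc k) f = Σℕ< k f ℕ.+ f k

  Σ<-pos : ∀ k f → Σ< k (λ i → + f i) ≡ + Σℕ< k f
  Σ<-pos zero f = refl
  Σ<-pos (suc k) f = trans (cong (_+ + f k) (Σ<-pos k f)) (sym (pos-+ (Σℕ< k f) (f k)))

  -- ballot m k is the number of descendants at depth m, in the generating tree of 321-avoiders,
  -- of a node with k active sites.
  ballot : ℕ → ℕ → ℕ
  ballot zero k = 1
  ballot (suc m) k = Σℕ< k (λ i → ballot m (suc (suc i)))

  2m+j : ℕ → ℕ → ℕ
  2m+j m j = m ℕ.+ m ℕ.+ j

  -- Closed form of ballot m (1 + j); at j = 0 it is C(2m, m) − C(2m, m − 1), the Catalan number.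
  ballotFormula : ℕ → ℕ → ℤ
  ballotFormula zero j = 1ℤ
  ballotFormula (suc m) j = + (2m+j (suc m) j C suc m) - + (2m+j (suc m) j C m)

  pascal : ∀ N k → + (suc N C suc k) ≡ + (N C k) + + (N C suc k)
  pascal N k = trans (cong +_ (sym (nCk+nC[k+1]≡[n+1]C[k+1] N k))) (pos-+ (N C k) (N C suc k))

  ballotFormula-suc-0 : ∀ m → ballotFormula (suc m) 0 ≡ ballotFormula m 1
  ballotFormula-suc-0 zero = refl
  ballotFormula-suc-0 (suc m) = begin
    ballotFormula (suc (suc m)) 0
      ≡⟨ cong (λ c → + (c C suc (suc m)) - + (c C suc m)) [4+2m]≡suc-M ⟩
    + (suc M C suc (suc m)) - + (suc M C suc m)
      ≡⟨ cong₂ _-_ (pascal M (suc m)) (pascal M m) ⟩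
    (+ (M C suc m) + + (M C suc (suc m))) - (+ (M C m) + + (M C suc m))
      ≡⟨ cong (λ c → (+ (M C suc m) + + c) - (+ (M C m) + + (M C suc m))) symmetric ⟩
    (+ (M C suc m) + + (M C suc m)) - (+ (M C m) + + (M C suc m))
      ≡⟨ cancel (+ (M C suc m)) (+ (M C m)) ⟩
    ballotFormula (suc m) 1 ∎
    where
    M = 2m+j (suc m) 1
    [4+2m]≡suc-M : 2m+j (suc (suc m)) 0 ≡ suc M
    [4+2m]≡suc-M = arith m
      where arith : ∀ m → (2 ℕ.+ m) ℕ.+ (2 ℕ.+ m) ℕ.+ 0 ≡ 1 ℕ.+ ((1 ℕ.+ m) ℕ.+ (1 ℕ.+ m) ℕ.+ 1)
            arith = ℕ-Solver.solve-∀
    M≡[2+m]+[1+m] : M ≡ suc (suc m) ℕ.+ suc m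
    M≡[2+m]+[1+m] = arith m
      where arith : ∀ m → (1 ℕ.+ m) ℕ.+ (1 ℕ.+ m) ℕ.+ 1 ≡ (2 ℕ.+ m) ℕ.+ (1 ℕ.+ m)
            arith = ℕ-Solver.solve-∀
    symmetric : M C suc (suc m) ≡ M C suc m
    symmetric = trans (nCk≡nC[n∸k] (subst (suc (suc m) ≤_) (sym M≡[2+m]+[1+m]) (ℕ.m≤m+n (suc (suc m)) (suc m))))
      (cong (M C_) (trans (cong (_∸ suc (suc m)) M≡[2+m]+[1+m]) (ℕ.m+n∸m≡n (suc (suc m)) (suc m))))
    cancel : ∀ a b → (a + a) - (b + a) ≡ a - b
    cancel = solve-∀

  ballotFormula-suc-suc : ∀ m j →
    ballotFormula (suc m) (suc j) ≡ ballotFormula (suc m) j + ballotFormula m (suc (suc j))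
  ballotFormula-suc-suc zero j = begin
    ballotFormula 1 (suc j)        ≡⟨ cong (λ c → + (c C 1) - + (c C 0)) (ℕ.+-suc 2 j) ⟩
    + (suc N C 1) - + (suc N C 0)  ≡⟨ cong (_- + (suc N C 0)) (pascal N 0) ⟩
    (+ (N C 0) + + (N C 1)) - 1ℤ   ≡⟨ rearrange (+ (N C 1)) ⟩
    (+ (N C 1) - 1ℤ) + 1ℤ          ∎
    where
    N = 2m+j 1 j
    rearrange : ∀ a → (1ℤ + a) - 1ℤ ≡ (a - 1ℤ) + 1ℤ
    rearrange = solve-∀
  ballotFormula-suc-suc (suc m) j = begin
    ballotFormula (suc (suc m)) (suc j)
      ≡⟨ cong (λ c → + (c C suc (suc m)) - + (c C suc m)) (ℕ.+-suc (suc (suc m) ℕ.+ suc (suc m)) j) ⟩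
    + (suc N C suc (suc m)) - + (suc N C suc m)
      ≡⟨ cong₂ _-_ (pascal N (suc m)) (pascal N m) ⟩
    (+ (N C suc m) + + (N C suc (suc m))) - (+ (N C m) + + (N C suc m))
      ≡⟨ rearrange (+ (N C suc m)) (+ (N C suc (suc m))) (+ (N C m)) ⟩
    (+ (N C suc (suc m)) - + (N C suc m)) + (+ (N C suc m) - + (N C m))
      ≡⟨ cong (λ c → (+ (N C suc (suc m)) - + (N C suc m)) + (+ (c C suc m) - + (c C m))) N≡ ⟩
    ballotFormula (suc (suc m)) j + ballotFormula (suc m) (suc (suc j)) ∎
    where
    N = 2m+j (suc (suc m)) j
    N≡ : N ≡ 2m+j (suc m) (suc (suc j))
    N≡ = arith m j
      where arith : ∀ m j → (2 ℕ.+ m) ℕ.+ (2 ℕ.+ m) ℕ.+ j ≡ (1 ℕ.+ m) ℕ.+ (1 ℕ.+ m) ℕ.+ (2 ℕ.+ j)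
            arith = ℕ-Solver.solve-∀
    rearrange : ∀ a b c → (a + b) - (c + a) ≡ (b - a) + (a - c)
    rearrange = solve-∀

  ballot≡ballotFormula : ∀ m j → + ballot m (suc j) ≡ ballotFormula m j
  ballot≡ballotFormula zero j = refl
  ballot≡ballotFormula (suc m) zero = trans (ballot≡ballotFormula m 1) (sym (ballotFormula-suc-0 m))
  ballot≡ballotFormula (suc m) (suc j) = begin
    + (ballot (suc m) (suc j) ℕ.+ ballot m (3 ℕ.+ j))
      ≡⟨ pos-+ (ballot (suc m) (suc j)) (ballot m (3 ℕ.+ j)) ⟩
    + ballot (suc m) (suc j) + + ballot m (3 ℕ.+ j)
      ≡⟨ cong₂ _+_ (ballot≡ballotFormula (suc m) j) (ballot≡ballotFormula m (suc (suc j))) ⟩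
    ballotFormula (suc m) j + ballotFormula m (suc (suc j))
      ≡⟨ sym (ballotFormula-suc-suc m j) ⟩
    ballotFormula (suc m) (suc j) ∎

  absorption : ∀ n k → suc k ℕ.* (suc n C suc k) ≡ suc n ℕ.* (n C k)
  absorption zero zero = refl
  absorption zero (suc k) = begin
    suc (suc k) ℕ.* (1 C suc (suc k))  ≡⟨ cong (suc (suc k) ℕ.*_) (k>n⇒nCk≡0 {1} {suc (suc k)} (s≤s (s≤s z≤n))) ⟩
    suc (suc k) ℕ.* 0                  ≡⟨ ℕ.*-zeroʳ (suc (suc k)) ⟩
    0                                  ≡⟨ sym (cong (1 ℕ.*_) (k>n⇒nCk≡0 {0} {suc k} (s≤s z≤n))) ⟩
    1 ℕ.* (0 C suc k)                  ∎
  absorption (suc n) zero = trans (ℕ.*-identityˡ _) (trans (nC1≡n (suc (suc n))) (sym (ℕ.*-identityʳ (suc (suc n)))))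
  absorption (suc n) (suc k) = begin
    suc (suc k) ℕ.* (suc (suc n) C suc (suc k))
      ≡⟨ cong (suc (suc k) ℕ.*_) (sym (nCk+nC[k+1]≡[n+1]C[k+1] (suc n) (suc k))) ⟩
    suc (suc k) ℕ.* (A ℕ.+ B)
      ≡⟨ distribute k A B ⟩
    A ℕ.+ (suc k ℕ.* A ℕ.+ suc (suc k) ℕ.* B)
      ≡⟨ cong (A ℕ.+_) (cong₂ ℕ._+_ (absorption n k) (absorption n (suc k))) ⟩
    A ℕ.+ (suc n ℕ.* (n C k) ℕ.+ suc n ℕ.* (n C suc k))
      ≡⟨ cong (A ℕ.+_) (sym (ℕ.*-distribˡ-+ (suc n) (n C k) (n C suc k))) ⟩
    A ℕ.+ suc n ℕ.* (n C k ℕ.+ n C suc k)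
      ≡⟨ cong (λ c → A ℕ.+ suc n ℕ.* c) (nCk+nC[k+1]≡[n+1]C[k+1] n k) ⟩
    suc (suc n) ℕ.* A ∎
    where
    A = suc n C suc k
    B = suc n C suc (suc k)
    distribute : ∀ k a b → (2 ℕ.+ k) ℕ.* (a ℕ.+ b) ≡ a ℕ.+ ((1 ℕ.+ k) ℕ.* a ℕ.+ (2 ℕ.+ k) ℕ.* b)
    distribute = ℕ-Solver.solve-∀

  [1+m]*C[2m+2,1+m]≡[2+m]*C[2m+2,m] : ∀ m → suc m ℕ.* (2m+j (suc m) 0 C suc m) ≡ suc (suc m) ℕ.* (2m+j (suc m) 0 C m)
  [1+m]*C[2m+2,1+m]≡[2+m]*C[2m+2,m] m = ℕ.+-cancelˡ-≡ (suc m ℕ.* Y) _ _ (begin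
    suc m ℕ.* Y ℕ.+ suc m ℕ.* X        ≡⟨ sym (ℕ.*-distribˡ-+ (suc m) Y X) ⟩
    suc m ℕ.* (Y ℕ.+ X)                ≡⟨ cong (suc m ℕ.*_) (nCk+nC[k+1]≡[n+1]C[k+1] N m) ⟩
    suc m ℕ.* (suc N C suc m)          ≡⟨ absorption N m ⟩
    suc N ℕ.* Y                        ≡⟨ cong (ℕ._* Y) (arith m) ⟩
    (suc m ℕ.+ suc (suc m)) ℕ.* Y      ≡⟨ ℕ.*-distribʳ-+ Y (suc m) (suc (suc m)) ⟩
    suc m ℕ.* Y ℕ.+ suc (suc m) ℕ.* Y  ∎)
    where
    N = 2m+j (suc m) 0
    X = N C suc m
    Y = N C m
    arith : ∀ m → 1 ℕ.+ ((1 ℕ.+ m) ℕ.+ (1 ℕ.+ m) ℕ.+ 0) ≡ (1 ℕ.+ m) ℕ.+ (2 ℕ.+ m)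
    arith = ℕ-Solver.solve-∀

  centralBinomial≡[1+n]*ballot : ∀ n → (2 ℕ.* n) C n ≡ suc n ℕ.* ballot n 1
  centralBinomial≡[1+n]*ballot zero = refl
  centralBinomial≡[1+n]*ballot (suc m) = +-injective (begin
    + ((2 ℕ.* suc m) C suc m)                ≡⟨ cong (λ c → + (c C suc m)) (arith m) ⟩
    + X                                      ≡⟨ solveFor (+ m) (+ X) (+ Y) [2+m]Y≡[1+m]X ⟩
    (+ m + 1ℤ + 1ℤ) * (+ X - + Y)            ≡⟨ cong (_* (+ X - + Y)) (sym (pos-suc-suc m)) ⟩
    + suc (suc m) * (+ X - + Y)              ≡⟨ cong (+ suc (suc m) *_) (sym (ballot≡ballotFormula (suc m) 0)) ⟩
    + suc (suc m) * + ballot (suc m) 1       ≡⟨ sym (pos-* (suc (suc m)) (ballot (suc m) 1)) ⟩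
    + (suc (suc m) ℕ.* ballot (suc m) 1)     ∎)
    where
    X = 2m+j (suc m) 0 C suc m
    Y = 2m+j (suc m) 0 C m
    arith : ∀ m → 2 ℕ.* (1 ℕ.+ m) ≡ (1 ℕ.+ m) ℕ.+ (1 ℕ.+ m) ℕ.+ 0
    arith = ℕ-Solver.solve-∀
    pos-suc : ∀ m → + suc m ≡ + m + 1ℤ
    pos-suc m = trans (cong +_ (ℕ.+-comm 1 m)) (pos-+ m 1)
    pos-suc-suc : ∀ m → + suc (suc m) ≡ + m + 1ℤ + 1ℤ
    pos-suc-suc m = trans (pos-suc (suc m)) (cong (_+ 1ℤ) (pos-suc m))
    [2+m]Y≡[1+m]X : (+ m + 1ℤ + 1ℤ) * + Y ≡ (+ m + 1ℤ) * + X
    [2+m]Y≡[1+m]X = begin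
      (+ m + 1ℤ + 1ℤ) * + Y        ≡⟨ cong (_* + Y) (sym (pos-suc-suc m)) ⟩
      + suc (suc m) * + Y          ≡⟨ sym (pos-* (suc (suc m)) Y) ⟩
      + (suc (suc m) ℕ.* Y)        ≡⟨ cong +_ (sym ([1+m]*C[2m+2,1+m]≡[2+m]*C[2m+2,m] m)) ⟩
      + (suc m ℕ.* X)              ≡⟨ pos-* (suc m) X ⟩
      + suc m * + X                ≡⟨ cong (_* + X) (pos-suc m) ⟩
      (+ m + 1ℤ) * + X             ∎
    solveFor : ∀ a x y → (a + 1ℤ + 1ℤ) * y ≡ (a + 1ℤ) * x → x ≡ (a + 1ℤ + 1ℤ) * (x - y)
    solveFor a x y h = begin
      x                                        ≡⟨ difference a x ⟩
      (a + 1ℤ + 1ℤ) * x - (a + 1ℤ) * x         ≡⟨ cong ((a + 1ℤ + 1ℤ) * x -_) (sym h) ⟩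
      (a + 1ℤ + 1ℤ) * x - (a + 1ℤ + 1ℤ) * y    ≡⟨ factor a x y ⟩
      (a + 1ℤ + 1ℤ) * (x - y)                  ∎
      where
      difference : ∀ a x → x ≡ (a + 1ℤ + 1ℤ) * x - (a + 1ℤ) * x
      difference = solve-∀
      factor : ∀ a x y → (a + 1ℤ + 1ℤ) * x - (a + 1ℤ + 1ℤ) * y ≡ (a + 1ℤ + 1ℤ) * (x - y)
      factor = solve-∀

  catalan≡ballot : ∀ n → catalan n ≡ ballot n 1
  catalan≡ballot n = begin
    ((2 ℕ.* n) C n) / suc n          ≡⟨ cong (_/ suc n) (centralBinomial≡[1+n]*ballot n) ⟩
    (suc n ℕ.* ballot n 1) / suc n   ≡⟨ cong (_/ suc n) (ℕ.*-comm (suc n) (ballot n 1)) ⟩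
    (ballot n 1 ℕ.* suc n) / suc n   ≡⟨ m*n/n≡m (ballot n 1) (suc n) ⟩
    ballot n 1                       ∎


module Avoiders where

  open import Defs
  open import Function using (_∘_; Equivalence)
  open import Data.Nat as ℕ using (ℕ; zero; suc; _<_; z≤n; s≤s; _<ᵇ_; _≡ᵇ_)
  import Data.Nat.Properties as ℕ
  open import Data.Bool using (true; false; not; _∧_; T; _≟_)
  open import Data.Bool.Properties using (T-∧)
  open import Data.Product using (_,_; proj₁; proj₂; _×_; ∃; ∃₂)
  open import Data.Fin as Fin using (Fin; toℕ; fromℕ<)
  import Data.Fin.Properties as Fin
  open import Data.Vec as Vec using (Vec; []; _∷_; lookup)
  import Data.Vec.Properties as Vec
  open import Data.List using (List; []; _∷_; map; length; allFin; applyUpTo)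
  import Data.List.Properties as List
  open import Data.List.Membership.Propositional using (_∈_; lose)
  open import Data.List.Membership.Propositional.Properties
  open import Data.List.Relation.Unary.Any as Any using (here)
  import Data.List.Relation.Unary.Any.Properties as Any
  import Data.List.Relation.Unary.All as All
  import Data.List.Relation.Unary.All.Properties as All
  open import Data.List.Relation.Unary.AllPairs using ([]; _∷_)
  open import Data.List.Relation.Unary.Unique.Propositional using (Unique)
  import Data.List.Relation.Unary.Unique.Propositional.Properties as Unique
  open import Relation.Nullary using (¬_)
  open import Relation.Binary.PropositionalEquality using (_≡_; _≢_; refl; sym; trans; cong; cong₂; subst; subst₂)
  open import Relation.Binary using (tri<; tri≈; tri>)
  open import Data.Empty using (⊥; ⊥-elim)
  open UniqueList

  -- Permutations are lists of naturals here rather than Vec (Fin n) n as in S321, so that inserting,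
  -- removing and splitting entries needs no bounds in the types; out of range, _!_ returns 0.
  infixl 9 _!_
  _!_ : List ℕ → ℕ → ℕ
  [] ! i = 0
  (x ∷ xs) ! zero = x
  (x ∷ xs) ! suc i = xs ! i

  applyUpTo-! : ∀ f n i → i < n → applyUpTo f n ! i ≡ f i
  applyUpTo-! f (suc n) zero _ = refl
  applyUpTo-! f (suc n) (suc i) (s≤s i<n) = applyUpTo-! (f ∘ suc) n i i<n

  !-ext : ∀ (u v : List ℕ) → length u ≡ length v → (∀ i → i < length u → u ! i ≡ v ! i) → u ≡ v
  !-ext [] [] _ _ = refl
  !-ext (x ∷ u) (y ∷ v) e h = cong₂ _∷_ (h 0 (s≤s z≤n)) (!-ext u v (ℕ.suc-injective e) (λ i i< → h (suc i) (s≤s i<)))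

  record Avoider (n : ℕ) (w : List ℕ) : Set where
    constructor avoider
    field
      length≡ : length w ≡ n
      bounded : ∀ i → i < n → w ! i < n
      injective : ∀ i j → i < n → j < n → w ! i ≡ w ! j → i ≡ j
      no321 : ∀ i j l → i < j → j < l → l < n → w ! j < w ! i → w ! l < w ! j → ⊥

  module _ {n : ℕ} (v : Vec (Fin n) n) where

    Distinct : Set
    Distinct = ∀ i j → toℕ i < toℕ j → toℕ (lookup v i) ≢ toℕ (lookup v j)

    Pattern321 : Fin n → Fin n → Fin n → Set
    Pattern321 i j l = toℕ i < toℕ j × toℕ j < toℕ l ×
      toℕ (lookup v j) < toℕ (lookup v i) × toℕ (lookup v l) < toℕ (lookup v j)

    private
      ¬T∧ : ∀ {a b} → T (not (a ∧ b)) → T a → T b → ⊥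
      ¬T∧ {true} {true} () _ _

      T-not∧ : ∀ {a b} → (T a → T b → ⊥) → T (not (a ∧ b))
      T-not∧ {false} _ = _
      T-not∧ {true} {false} _ = _
      T-not∧ {true} {true} h = h _ _

      ∈allFin : ∀ {P : Fin n → Set} → (∀ i → P i) → All.All P (allFin n)
      ∈allFin h = All.tabulate (λ {i} _ → h i)

    T-isPerm⁻ : T (isPerm v) → Distinct
    T-isPerm⁻ h i j i<j same = ¬T∧
      (All.lookup (All.all⁺ _ _ (All.lookup (All.all⁺ _ _ h) (∈-allFin i))) (∈-allFin j))
      (ℕ.<⇒<ᵇ i<j) (ℕ.≡⇒≡ᵇ _ _ same)

    T-isPerm⁺ : Distinct → T (isPerm v)
    T-isPerm⁺ distinct = All.all⁻ _ (∈allFin λ i → All.all⁻ _ (∈allFin λ j → T-not∧ λ i<j same →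
      distinct i j (ℕ.<ᵇ⇒< _ _ i<j) (ℕ.≡ᵇ⇒≡ _ _ same)))

    T-has321⁻ : T (has321 v) → ∃ λ i → ∃₂ λ j l → Pattern321 i j l
    T-has321⁻ h with Any.satisfied (Any.any⁻ _ (allFin n) h)
    ... | i , hi with Any.satisfied (Any.any⁻ _ (allFin n) hi)
    ... | j , hj with Any.satisfied (Any.any⁻ _ (allFin n) hj)
    ... | l , hl with Equivalence.to T-∧ hl
    ... | i<j , rest with Equivalence.to T-∧ rest
    ... | j<l , rest′ with Equivalence.to T-∧ rest′
    ... | vj<vi , vl<vj =
      i , j , l , ℕ.<ᵇ⇒< _ _ i<j , ℕ.<ᵇ⇒< _ _ j<l , ℕ.<ᵇ⇒< _ _ vj<vi , ℕ.<ᵇ⇒< _ _ vl<vj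

    T-has321⁺ : ∀ i j l → Pattern321 i j l → T (has321 v)
    T-has321⁺ i j l (i<j , j<l , vj<vi , vl<vj) =
      Any.any⁺ _ (lose (∈-allFin i) (Any.any⁺ _ (lose (∈-allFin j) (Any.any⁺ _ (lose (∈-allFin l)
        (Equivalence.from T-∧ (ℕ.<⇒<ᵇ i<j , Equivalence.from T-∧ (ℕ.<⇒<ᵇ j<l ,
          Equivalence.from T-∧ (ℕ.<⇒<ᵇ vj<vi , ℕ.<⇒<ᵇ vl<vj)))))))))

  toℕs : ∀ {m n} → Vec (Fin m) n → List ℕ
  toℕs [] = []
  toℕs (x ∷ v) = toℕ x ∷ toℕs v

  length-toℕs : ∀ {m n} (v : Vec (Fin m) n) → length (toℕs v) ≡ n
  length-toℕs [] = refl
  length-toℕs (x ∷ v) = cong suc (length-toℕs v)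

  toℕs-! : ∀ {m n} (v : Vec (Fin m) n) (i : Fin n) → toℕs v ! toℕ i ≡ toℕ (lookup v i)
  toℕs-! (x ∷ v) Fin.zero = refl
  toℕs-! (x ∷ v) (Fin.suc i) = toℕs-! v i

  toℕs-!-fromℕ< : ∀ {m n} (v : Vec (Fin m) n) k (k<n : k < n) → toℕs v ! k ≡ toℕ (lookup v (fromℕ< k<n))
  toℕs-!-fromℕ< v k k<n = trans (cong (toℕs v !_) (sym (Fin.toℕ-fromℕ< k<n))) (toℕs-! v (fromℕ< k<n))

  toℕs-injective : ∀ {m n} (v v′ : Vec (Fin m) n) → toℕs v ≡ toℕs v′ → v ≡ v′
  toℕs-injective [] [] _ = refl
  toℕs-injective (x ∷ v) (y ∷ v′) e =
    cong₂ _∷_ (Fin.toℕ-injective (List.∷-injectiveˡ e)) (toℕs-injective v v′ (List.∷-injectiveʳ e))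

  module _ {n : ℕ} (v : Vec (Fin n) n) where

    selected⇒Avoider : T (isPerm v) → ¬ T (has321 v) → Avoider n (toℕs v)
    selected⇒Avoider perm no-pattern = avoider (length-toℕs v) bounded injective no321
      where
      index : ∀ {k} → k < n → Fin n
      index k<n = fromℕ< k<n
      entry : ∀ {k} (k<n : k < n) → toℕs v ! k ≡ toℕ (lookup v (index k<n))
      entry = toℕs-!-fromℕ< v _
      position : ∀ {k} (k<n : k < n) → toℕ (index k<n) ≡ k
      position k<n = Fin.toℕ-fromℕ< k<n

      bounded : ∀ i → i < n → toℕs v ! i < n
      bounded i i<n = subst (_< n) (sym (entry i<n)) (Fin.toℕ<n _)

      distinct : ∀ i j (i<n : i < n) (j<n : j < n) → i < j → toℕs v ! i ≢ toℕs v ! j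
      distinct i j i<n j<n i<j same = T-isPerm⁻ v perm (index i<n) (index j<n)
        (subst₂ _<_ (sym (position i<n)) (sym (position j<n)) i<j)
        (trans (sym (entry i<n)) (trans same (entry j<n)))

      injective : ∀ i j → i < n → j < n → toℕs v ! i ≡ toℕs v ! j → i ≡ j
      injective i j i<n j<n same with ℕ.<-cmp i j
      ... | tri< i<j _ _ = ⊥-elim (distinct i j i<n j<n i<j same)
      ... | tri≈ _ i≡j _ = i≡j
      ... | tri> _ _ j<i = ⊥-elim (distinct j i j<n i<n j<i (sym same))

      no321 : ∀ i j l → i < j → j < l → l < n → toℕs v ! j < toℕs v ! i → toℕs v ! l < toℕs v ! j → ⊥
      no321 i j l i<j j<l l<n wj<wi wl<wj = no-pattern (T-has321⁺ v (index i<n) (index j<n) (index l<n)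
        ( subst₂ _<_ (sym (position i<n)) (sym (position j<n)) i<j
        , subst₂ _<_ (sym (position j<n)) (sym (position l<n)) j<l
        , subst₂ _<_ (entry j<n) (entry i<n) wj<wi
        , subst₂ _<_ (entry l<n) (entry j<n) wl<wj))
        where j<n = ℕ.<-trans j<l l<n
              i<n = ℕ.<-trans i<j j<n

    Avoider⇒selected : Avoider n (toℕs v) → T (isPerm v) × ¬ T (has321 v)
    Avoider⇒selected (avoider _ _ injective no321) = perm , no-pattern
      where
      perm : T (isPerm v)
      perm = T-isPerm⁺ v λ i j i<j same → ℕ.<-irrefl
        (injective (toℕ i) (toℕ j) (Fin.toℕ<n i) (Fin.toℕ<n j)
          (trans (toℕs-! v i) (trans same (sym (toℕs-! v j)))))
        i<j
      no-pattern : ¬ T (has321 v)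
      no-pattern h with T-has321⁻ v h
      ... | i , j , l , i<j , j<l , vj<vi , vl<vj = no321 (toℕ i) (toℕ j) (toℕ l) i<j j<l (Fin.toℕ<n l)
        (subst₂ _<_ (sym (toℕs-! v j)) (sym (toℕs-! v i)) vj<vi)
        (subst₂ _<_ (sym (toℕs-! v l)) (sym (toℕs-! v j)) vl<vj)

  ∈-allVec : ∀ m n (v : Vec (Fin m) n) → v ∈ allVec m n
  ∈-allVec m zero [] = here refl
  ∈-allVec m (suc n) (x ∷ v) = ∈-concatMap⁺ (λ i → map (i ∷_) (allVec m n))
    (Any.map (λ { refl → ∈-map⁺ (x ∷_) (∈-allVec m n v) }) (∈-allFin x))

  allVec-unique : ∀ m n → Unique (allVec m n)
  allVec-unique m zero = All.[] ∷ []
  allVec-unique m (suc n) = Unique-concatMap (λ i → map (i ∷_) (allVec m n)) (allFin m) (Unique.allFin⁺ m)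
    (λ i _ → Unique.map⁺ Vec.∷-injectiveʳ (allVec-unique m n))
    (λ i j u _ _ u∈ u∈′ → trans (sym (head u∈)) (head u∈′))
    where
    head : ∀ {u i} → u ∈ map (i ∷_) (allVec m n) → Vec.head u ≡ i
    head u∈ with ∈-map⁻ _ u∈
    ... | _ , _ , refl = refl

  avoiders : ℕ → List (List ℕ)
  avoiders n = map toℕs (S321 n)

  avoiders-unique : ∀ n → Unique (avoiders n)
  avoiders-unique n = Unique.map⁺ (toℕs-injective _ _) (Unique.filter⁺ _ (allVec-unique n n))

  private
    selected⁻ : ∀ {a b} → (a ∧ not b) ≡ true → T a × ¬ T b
    selected⁻ {true} {false} refl = _ , λ ()

    selected⁺ : ∀ {a b} → T a → ¬ T b → (a ∧ not b) ≡ true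
    selected⁺ {true} {false} _ _ = refl
    selected⁺ {true} {true} _ ¬b = ⊥-elim (¬b _)

  ∈-avoiders⁻ : ∀ {n w} → w ∈ avoiders n → Avoider n w
  ∈-avoiders⁻ {n} w∈ with ∈-map⁻ toℕs w∈
  ... | v , v∈ , refl with selected⁻ (proj₂ (∈-filter⁻ (λ u → isPerm u ∧ not (has321 u) ≟ true) {xs = allVec n n} v∈))
  ... | perm , no-pattern = selected⇒Avoider v perm no-pattern

  ∈-avoiders⁺ : ∀ {n w} → Avoider n w → w ∈ avoiders n
  ∈-avoiders⁺ {n} {w} w-avoids = subst (_∈ avoiders n) toℕs-v≡w
    (∈-map⁺ toℕs (∈-filter⁺ (λ u → isPerm u ∧ not (has321 u) ≟ true) (∈-allVec n n v) (selected⁺ perm no-pattern)))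
    where
    open Avoider w-avoids
    v : Vec (Fin n) n
    v = Vec.tabulate (λ i → fromℕ< (bounded (toℕ i) (Fin.toℕ<n i)))
    toℕs-v≡w : toℕs v ≡ w
    toℕs-v≡w = !-ext (toℕs v) w (trans (length-toℕs v) (sym length≡)) λ k k< →
      let k<n = subst (k <_) (length-toℕs v) k< in
      trans (toℕs-!-fromℕ< v k k<n) (trans (cong toℕ (Vec.lookup∘tabulate _ (fromℕ< k<n)))
        (trans (Fin.toℕ-fromℕ< _) (cong (w !_) (Fin.toℕ-fromℕ< k<n))))
    selected = Avoider⇒selected v (subst (Avoider n) (sym toℕs-v≡w) w-avoids)
    perm = proj₁ selected
    no-pattern = proj₂ selected


module Range where

  open import Defs using (ΣZ)
  open import Data.Nat as ℕ using (ℕ; _<_; _≤_; _+_)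
  import Data.Nat.Properties as ℕ
  open import Data.Integer using (ℤ)
  open import Data.Product using (_,_; _×_)
  open import Data.List using (List; map; length; upTo)
  import Data.List.Properties as List
  open import Data.List.Membership.Propositional using (_∈_)
  open import Data.List.Membership.Propositional.Properties using (∈-map⁺; ∈-map⁻; ∈-upTo⁺; ∈-upTo⁻)
  open import Data.List.Relation.Unary.Unique.Propositional using (Unique)
  import Data.List.Relation.Unary.Unique.Propositional.Properties as Unique
  open import Relation.Binary.PropositionalEquality using (_≡_; refl; trans; subst; sym)
  open IntegerListSum using (ΣZ-map)
  open RangeSum using (Σ<; ΣZ-upTo)

  range : ℕ → ℕ → List ℕ
  range a c = map (a +_) (upTo c)

  length-range : ∀ a c → length (range a c) ≡ c
  length-range a c = trans (List.length-map _ (upTo c)) (List.length-upTo c)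

  ∈-range⁺ : ∀ {a c x} → a ≤ x → x < a + c → x ∈ range a c
  ∈-range⁺ {a} {c} {x} a≤x x< = subst (_∈ range a c) (ℕ.m+[n∸m]≡n a≤x)
    (∈-map⁺ (a +_) (∈-upTo⁺ (ℕ.+-cancelˡ-< a _ _ (subst (_< a + c) (sym (ℕ.m+[n∸m]≡n a≤x)) x<))))

  ∈-range⁻ : ∀ {a c x} → x ∈ range a c → a ≤ x × x < a + c
  ∈-range⁻ {a} x∈ with ∈-map⁻ (a +_) x∈
  ... | k , k∈ , refl = ℕ.m≤m+n a k , ℕ.+-monoʳ-< a (∈-upTo⁻ k∈)

  range-unique : ∀ a c → Unique (range a c)
  range-unique a c = Unique.map⁺ (ℕ.+-cancelˡ-≡ a _ _) (Unique.upTo⁺ c)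

  ΣZ-range : ∀ (f : ℕ → ℤ) a c → ΣZ (map f (range a c)) ≡ Σ< c (λ i → f (a + i))
  ΣZ-range f a c = trans (ΣZ-map f (a +_) (upTo c)) (ΣZ-upTo _ c)


module AvoiderStructure where

  open import Data.Nat as ℕ using (ℕ; suc; _<_; _≤_; z≤n; s≤s; _∸_)
  import Data.Nat.Properties as ℕ
  open import Data.Product using (_,_; proj₁; proj₂; _×_; ∃)
  open import Data.List using (List; []; _∷_; map; length)
  import Data.List.Properties as List
  open import Data.List.Membership.Propositional using (_∈_; find; lose)
  open import Data.List.Membership.Propositional.Properties using (∈-map⁻)
  open import Data.List.Relation.Unary.Any using (here; there; any?)
  open import Data.List.Relation.Unary.All as All using (_∷_)
  open import Data.List.Relation.Unary.AllPairs using (_∷_)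
  open import Data.List.Relation.Unary.Unique.Propositional using (Unique)
  open import Relation.Nullary using (yes; no)
  open import Relation.Binary.PropositionalEquality using (_≡_; _≢_; refl; sym; trans; cong; subst; subst₂)
  open import Relation.Binary using (tri<; tri≈; tri>)
  open import Data.Empty using (⊥-elim)
  open UniqueList using (Unique-map)
  open Avoiders
  open Range

  ∈-remove : ∀ {x : ℕ} {ys} → x ∈ ys →
             ∃ λ ys′ → length ys ≡ suc (length ys′) × (∀ z → z ∈ ys → z ≢ x → z ∈ ys′)
  ∈-remove {ys = y ∷ ys} (here refl) = ys , refl , λ { z (here refl) z≢y → ⊥-elim (z≢y refl) ; z (there z∈) _ → z∈ }
  ∈-remove {ys = y ∷ ys} (there x∈) with ∈-remove x∈
  ... | ys′ , e , keep = y ∷ ys′ , cong suc e , λ { z (here refl) _ → here refl ; z (there z∈) z≢x → there (keep z z∈ z≢x) }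

  pigeonhole : ∀ (xs ys : List ℕ) → Unique xs → (∀ x → x ∈ xs → x ∈ ys) → length xs ≤ length ys
  pigeonhole [] ys _ _ = z≤n
  pigeonhole (x ∷ xs) ys (x∉ ∷ u) ⊆ys with ∈-remove (⊆ys x (here refl))
  ... | ys′ , e , keep = subst (suc (length xs) ≤_) (sym e) (s≤s (pigeonhole xs ys′ u (λ z z∈ →
        keep z (⊆ys z (there z∈)) (λ { refl → All.lookup x∉ z∈ refl }))))

  Avoider-pigeonhole : ∀ {n w} → Avoider n w → (xs ys : List ℕ) → Unique xs → (∀ x → x ∈ xs → x < n) →
                       (∀ x → x ∈ xs → w ! x ∈ ys) → length xs ≤ length ys
  Avoider-pigeonhole {n} {w} w-avoids xs ys u xs<n maps-into = subst (_≤ length ys) (List.length-map (w !_) xs)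
    (pigeonhole (map (w !_) xs) ys
      (Unique-map (w !_) xs (λ x y x∈ y∈ → Avoider.injective w-avoids x y (xs<n x x∈) (xs<n y y∈)) u)
      (λ z z∈ → image z∈))
    where
    image : ∀ {z} → z ∈ map (w !_) xs → z ∈ ys
    image z∈ with ∈-map⁻ (w !_) z∈
    ... | x , x∈ , refl = maps-into x x∈

  -- Otherwise the n + 1 positions would be sent injectively into the values 0, …, n-1.
  max-position : ∀ {n w} → Avoider (suc n) w → ∃ λ p → p < suc n × w ! p ≡ n
  max-position {n} {w} w-avoids with any? (λ p → w ! p ℕ.≟ n) (range 0 (suc n))
  ... | yes found with find found
  ...   | p , p∈ , wp≡n = p , proj₂ (∈-range⁻ p∈) , wp≡n
  max-position {n} {w} w-avoids | no none = ⊥-elim (ℕ.<-irrefl refl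
    (subst₂ _≤_ (length-range 0 (suc n)) (length-range 0 n)
      (Avoider-pigeonhole w-avoids (range 0 (suc n)) (range 0 n) (range-unique 0 (suc n))
        (λ p p∈ → proj₂ (∈-range⁻ p∈))
        (λ p p∈ → ∈-range⁺ z≤n (ℕ.≤∧≢⇒< (ℕ.≤-pred (bounded p (proj₂ (∈-range⁻ p∈))))
                                         (λ wp≡n → none (lose p∈ wp≡n)))))))
    where open Avoider w-avoids

  module FixedPoint {n w m} (w-avoids : Avoider n w) (m<n : m < n) (fixed : w ! m ≡ m) where
    open Avoider w-avoids

    private
      ≢m : ∀ i → i < n → i ≢ m → w ! i ≢ m
      ≢m i i<n i≢m wi≡m = i≢m (injective i m i<n m<n (trans wi≡m (sym fixed)))

      after : List ℕ
      after = range (suc m) (n ∸ suc m)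

      ∈-after⁻ : ∀ {l} → l ∈ after → m < l × l < n
      ∈-after⁻ l∈ with ∈-range⁻ l∈
      ... | m<l , l<end = m<l , subst (_ <_) (ℕ.m+[n∸m]≡n m<n) l<end

      ∈-after⁺ : ∀ {l} → m < l → l < n → l ∈ after
      ∈-after⁺ m<l l<n = ∈-range⁺ m<l (subst (_ <_) (sym (ℕ.m+[n∸m]≡n m<n)) l<n)

    -- Otherwise the positions i, m+1, …, n-1 would be sent injectively into the values m+1, …, n-1.
    larger-before⇒smaller-after : ∀ i → i < m → m < w ! i → ∃ λ l → m < l × l < n × w ! l < m
    larger-before⇒smaller-after i i<m m<wi with any? (λ l → w ! l ℕ.<? m) after
    ... | yes found with find found
    ...   | l , l∈ , wl<m = l , proj₁ (∈-after⁻ l∈) , proj₂ (∈-after⁻ l∈) , wl<m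
    larger-before⇒smaller-after i i<m m<wi | no none = ⊥-elim (ℕ.<-irrefl refl
      (subst₂ _≤_ (cong suc (length-range (suc m) (n ∸ suc m))) (length-range (suc m) (n ∸ suc m))
        (Avoider-pigeonhole w-avoids (i ∷ after) after unique positions values)))
      where
      unique : Unique (i ∷ after)
      unique = All.tabulate (λ l∈ i≡l → ℕ.<-irrefl i≡l (ℕ.<-trans i<m (proj₁ (∈-after⁻ l∈)))) ∷ range-unique _ _
      positions : ∀ l → l ∈ i ∷ after → l < n
      positions l (here refl) = ℕ.<-trans i<m m<n
      positions l (there l∈) = proj₂ (∈-after⁻ l∈)
      values : ∀ l → l ∈ i ∷ after → w ! l ∈ after
      values l (here refl) = ∈-after⁺ m<wi (bounded i (ℕ.<-trans i<m m<n))
      values l (there l∈) = ∈-after⁺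
        (ℕ.≤∧≢⇒< (ℕ.≮⇒≥ (λ wl<m → none (lose l∈ wl<m)))
                 (λ m≡wl → ≢m l (proj₂ (∈-after⁻ l∈)) (λ l≡m → ℕ.<-irrefl (sym l≡m) (proj₁ (∈-after⁻ l∈)))
                              (sym m≡wl)))
        (bounded l (proj₂ (∈-after⁻ l∈)))

    before-fixed-point : ∀ i → i < m → w ! i < m
    before-fixed-point i i<m with ℕ.<-cmp (w ! i) m
    ... | tri< wi<m _ _ = wi<m
    ... | tri≈ _ wi≡m _ = ⊥-elim (≢m i (ℕ.<-trans i<m m<n) (ℕ.<⇒≢ i<m) wi≡m)
    ... | tri> _ _ m<wi with larger-before⇒smaller-after i i<m m<wi
    ... | l , m<l , l<n , wl<m = ⊥-elim (no321 i m l i<m m<l l<n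
            (subst (_< w ! i) (sym fixed) m<wi) (subst (w ! l <_) (sym fixed) wl<m))

    -- Otherwise the positions l, 0, …, m-1 would be sent injectively into the values 0, …, m-1.
    after-fixed-point : ∀ l → m < l → l < n → m < w ! l
    after-fixed-point l m<l l<n with ℕ.<-cmp (w ! l) m
    ... | tri> _ _ m<wl = m<wl
    ... | tri≈ _ wl≡m _ = ⊥-elim (≢m l l<n (λ l≡m → ℕ.<-irrefl (sym l≡m) m<l) wl≡m)
    ... | tri< wl<m _ _ = ⊥-elim (ℕ.<-irrefl refl (subst₂ _≤_ (cong suc (length-range 0 m)) (length-range 0 m)
        (Avoider-pigeonhole w-avoids (l ∷ range 0 m) (range 0 m) unique positions values)))
      where
      unique : Unique (l ∷ range 0 m)
      unique = All.tabulate (λ i∈ l≡i → ℕ.<-irrefl (sym l≡i) (ℕ.<-trans (proj₂ (∈-range⁻ i∈)) m<l)) ∷ range-unique _ _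
      positions : ∀ i → i ∈ l ∷ range 0 m → i < n
      positions i (here refl) = l<n
      positions i (there i∈) = ℕ.<-trans (proj₂ (∈-range⁻ i∈)) m<n
      values : ∀ i → i ∈ l ∷ range 0 m → w ! i ∈ range 0 m
      values i (here refl) = ∈-range⁺ z≤n wl<m
      values i (there i∈) = ∈-range⁺ z≤n (before-fixed-point i (proj₂ (∈-range⁻ i∈)))


module Insertion where

  open import Function using (_∘_)
  open import Data.Nat as ℕ using (ℕ; zero; suc; pred; _<_; _≤_; z≤n; s≤s; _+_)
  import Data.Nat.Properties as ℕ
  open import Data.Product using (Σ; _,_; proj₁; proj₂; _×_)
  open import Data.Sum using (inj₁; inj₂; [_,_]′)
  open import Data.List using (List; applyUpTo)
  import Data.List.Properties as List
  open import Relation.Nullary using (Dec; yes; no; ¬_)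
  open import Relation.Nullary.Decidable using (_→-dec_)
  open import Relation.Binary.PropositionalEquality as ≡ using (_≡_; _≢_; refl; sym; trans; cong; subst; subst₂)
  open import Data.Empty using (⊥; ⊥-elim)
  open import Relation.Binary using (tri<; tri≈; tri>)
  open Avoiders
  open ≡.≡-Reasoning

  all<? : (Q : ℕ → Set) → (∀ j → Dec (Q j)) → ∀ N → Dec (∀ j → j < N → Q j)
  all<? Q Q? zero = yes (λ j ())
  all<? Q Q? (suc N) with all<? Q Q? N | Q? N
  ... | yes below | yes at = yes (λ j j<1+N → [ below j , (λ { refl → at }) ]′ (ℕ.m<1+n⇒m<n∨m≡n j<1+N))
  ... | yes _ | no ¬at = no (λ all → ¬at (all N (ℕ.n<1+n N)))
  ... | no ¬below | _ = no (λ all → ¬below (λ j j<N → all j (ℕ.m<n⇒m<1+n j<N)))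

  least : (P : ℕ → Set) → (∀ p → Dec (P p)) → ∀ N → P N → Σ ℕ λ t → t ≤ N × P t × (∀ p → p < t → ¬ P p)
  least P P? N PN with P? 0
  ... | yes P0 = 0 , z≤n , P0 , λ p ()
  least P P? zero PN | no ¬P0 = ⊥-elim (¬P0 PN)
  least P P? (suc N) PN | no ¬P0 with least (P ∘ suc) (P? ∘ suc) N PN
  ... | t , t≤N , Pt , below = suc t , s≤s t≤N , Pt , λ { zero _ → ¬P0 ; (suc p) (s≤s p<t) → below p p<t }

  least-unique : (P : ℕ → Set) {t t′ : ℕ} → P t → (∀ p → p < t → ¬ P p) →
                 P t′ → (∀ p → p < t′ → ¬ P p) → t ≡ t′
  least-unique P {t} {t′} Pt below Pt′ below′ with ℕ.<-cmp t t′
  ... | tri< t<t′ _ _ = ⊥-elim (below′ t t<t′ Pt)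
  ... | tri≈ _ t≡t′ _ = t≡t′
  ... | tri> _ _ t′<t = ⊥-elim (below t′ t′<t Pt′)

  IncreasingFrom : List ℕ → ℕ → ℕ → Set
  IncreasingFrom σ n p = ∀ j → j < n → p ≤ j → suc j < n → σ ! j < σ ! suc j

  IncreasingFrom? : ∀ σ n p → Dec (IncreasingFrom σ n p)
  IncreasingFrom? σ n p = all<? _ (λ j → (p ℕ.≤? j) →-dec ((suc j ℕ.<? n) →-dec (σ ! j ℕ.<? σ ! suc j))) n

  IncreasingFrom-length : ∀ σ n → IncreasingFrom σ n n
  IncreasingFrom-length σ n j j<n n≤j _ = ⊥-elim (ℕ.<-irrefl refl (ℕ.<-≤-trans j<n n≤j))

  IncreasingFrom-mono : ∀ {σ n p q} → p ≤ q → IncreasingFrom σ n p → IncreasingFrom σ n q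
  IncreasingFrom-mono p≤q increasing j j<n q≤j 1+j<n = increasing j j<n (ℕ.≤-trans p≤q q≤j) 1+j<n

  IncreasingFrom⇒< : ∀ {σ n p} → IncreasingFrom σ n p → ∀ j l → p ≤ j → j < l → l < n → σ ! j < σ ! l
  IncreasingFrom⇒< {σ} increasing j (suc l) p≤j (s≤s j≤l) 1+l<n with ℕ.m≤n⇒m<n∨m≡n j≤l
  ... | inj₂ refl = increasing j (ℕ.<-trans (ℕ.n<1+n j) 1+l<n) p≤j 1+l<n
  ... | inj₁ j<l = ℕ.<-trans (IncreasingFrom⇒< {σ} increasing j l p≤j j<l (ℕ.<-trans (ℕ.n<1+n l) 1+l<n))
                     (increasing l (ℕ.<-trans (ℕ.n<1+n l) 1+l<n) (ℕ.≤-trans p≤j (ℕ.<⇒≤ j<l)) 1+l<n)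

  private
    finalRun : ∀ σ n → Σ ℕ λ t → t ≤ n × IncreasingFrom σ n t × (∀ p → p < t → ¬ IncreasingFrom σ n p)
    finalRun σ n = least (IncreasingFrom σ n) (IncreasingFrom? σ n) n (IncreasingFrom-length σ n)

  runStart : List ℕ → ℕ → ℕ
  runStart σ n = proj₁ (finalRun σ n)

  runStart≤ : ∀ σ n → runStart σ n ≤ n
  runStart≤ σ n = proj₁ (proj₂ (finalRun σ n))

  runStart-increasing : ∀ σ n → IncreasingFrom σ n (runStart σ n)
  runStart-increasing σ n = proj₁ (proj₂ (proj₂ (finalRun σ n)))

  runStart-least : ∀ σ n p → p < runStart σ n → ¬ IncreasingFrom σ n p
  runStart-least σ n = proj₂ (proj₂ (proj₂ (finalRun σ n)))

  runStart-unique : ∀ σ n t → IncreasingFrom σ n t → (∀ p → p < t → ¬ IncreasingFrom σ n p) → runStart σ n ≡ t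
  runStart-unique σ n t increasing below = least-unique (IncreasingFrom σ n) (runStart-increasing σ n) (runStart-least σ n) increasing below

  runStart-minimal : ∀ σ n p → IncreasingFrom σ n p → runStart σ n ≤ p
  runStart-minimal σ n p increasing = ℕ.≮⇒≥ (λ p<t → runStart-least σ n p p<t increasing)

  punchOut : ℕ → ℕ → ℕ
  punchOut p i with ℕ.<-cmp i p
  ... | tri< _ _ _ = i
  ... | tri≈ _ _ _ = i
  ... | tri> _ _ _ = pred i

  punchOut-below : ∀ {p i} → i < p → punchOut p i ≡ i
  punchOut-below {p} {i} i<p with ℕ.<-cmp i p
  ... | tri< _ _ _ = refl
  ... | tri≈ _ _ _ = refl
  ... | tri> _ _ c = ⊥-elim (ℕ.<-asym i<p c)

  suc-punchOut-above : ∀ {p i} → p < i → suc (punchOut p i) ≡ i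
  suc-punchOut-above {p} {i} p<i with ℕ.<-cmp i p
  ... | tri< a _ _ = ⊥-elim (ℕ.<-asym a p<i)
  ... | tri≈ _ b _ = ⊥-elim (ℕ.<-irrefl (sym b) p<i)
  ... | tri> _ _ (s≤s _) = refl

  punchIn : ℕ → ℕ → ℕ
  punchIn p i with ℕ.<-cmp i p
  ... | tri< _ _ _ = i
  ... | tri≈ _ _ _ = suc i
  ... | tri> _ _ _ = suc i

  punchIn-below : ∀ {p i} → i < p → punchIn p i ≡ i
  punchIn-below {p} {i} i<p with ℕ.<-cmp i p
  ... | tri< _ _ _ = refl
  ... | tri≈ _ b _ = ⊥-elim (ℕ.<-irrefl b i<p)
  ... | tri> _ _ c = ⊥-elim (ℕ.<-asym i<p c)

  punchIn-above : ∀ {p i} → p ≤ i → punchIn p i ≡ suc i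
  punchIn-above {p} {i} p≤i with ℕ.<-cmp i p
  ... | tri< a _ _ = ⊥-elim (ℕ.<⇒≱ a p≤i)
  ... | tri≈ _ _ _ = refl
  ... | tri> _ _ _ = refl

  insertEntry : ℕ → ℕ → List ℕ → ℕ → ℕ
  insertEntry p v σ i with ℕ.<-cmp i p
  ... | tri< _ _ _ = σ ! i
  ... | tri≈ _ _ _ = v
  ... | tri> _ _ _ = σ ! pred i

  insertEntry-at : ∀ {p v σ} → insertEntry p v σ p ≡ v
  insertEntry-at {p} with ℕ.<-cmp p p
  ... | tri≈ _ _ _ = refl
  ... | tri< p<p _ _ = ⊥-elim (ℕ.<-irrefl refl p<p)
  ... | tri> _ _ p<p = ⊥-elim (ℕ.<-irrefl refl p<p)

  insertEntry-off : ∀ {p v σ i} → i ≢ p → insertEntry p v σ i ≡ σ ! punchOut p i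
  insertEntry-off {p} {i = i} i≢p with ℕ.<-cmp i p
  ... | tri≈ _ i≡p _ = ⊥-elim (i≢p i≡p)
  ... | tri< _ _ _ = refl
  ... | tri> _ _ _ = refl

  insertMax : ℕ → List ℕ → ℕ → List ℕ
  insertMax p σ n = applyUpTo (insertEntry p n σ) (suc n)

  removeAt : ℕ → List ℕ → ℕ → List ℕ
  removeAt p π n = applyUpTo (λ i → π ! punchIn p i) n

  punchOut-punchIn : ∀ p i → punchOut p (punchIn p i) ≡ i
  punchOut-punchIn p i with ℕ.<-cmp i p
  ... | tri< a _ _ = punchOut-below a
  ... | tri≈ _ refl _ = ℕ.suc-injective (suc-punchOut-above (ℕ.n<1+n i))
  ... | tri> _ _ c = ℕ.suc-injective (suc-punchOut-above (ℕ.<-trans c (ℕ.n<1+n i)))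

  punchIn-punchOut : ∀ {p i} → i ≢ p → punchIn p (punchOut p i) ≡ i
  punchIn-punchOut {p} {i} i≢p with ℕ.<-cmp i p
  ... | tri< i<p _ _ = punchIn-below i<p
  ... | tri≈ _ i≡p _ = ⊥-elim (i≢p i≡p)
  ... | tri> _ _ (s≤s p≤i) = punchIn-above p≤i

  punchIn≢ : ∀ p i → punchIn p i ≢ p
  punchIn≢ p i with ℕ.<-cmp i p
  ... | tri< a _ _ = λ e → ℕ.<-irrefl e a
  ... | tri≈ _ refl _ = λ e → ℕ.<-irrefl (sym e) (ℕ.n<1+n i)
  ... | tri> _ _ c = λ e → ℕ.<-irrefl (sym e) (ℕ.<-trans c (ℕ.n<1+n i))

  punchIn-mono : ∀ p {i j} → i < j → punchIn p i < punchIn p j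
  punchIn-mono p {i} {j} i<j with ℕ.<-cmp i p | ℕ.<-cmp j p
  ... | tri< a _ _ | tri< b _ _ = i<j
  ... | tri< a _ _ | tri≈ _ b _ = ℕ.<-trans i<j (ℕ.n<1+n j)
  ... | tri< a _ _ | tri> _ _ c = ℕ.<-trans i<j (ℕ.n<1+n j)
  ... | tri≈ _ a _ | tri< b _ _ = ⊥-elim (ℕ.<-asym (subst (_< j) a i<j) b)
  ... | tri≈ _ a _ | tri≈ _ _ _ = s≤s i<j
  ... | tri≈ _ a _ | tri> _ _ _ = s≤s i<j
  ... | tri> _ _ a | tri< b _ _ = ⊥-elim (ℕ.<-asym (ℕ.<-trans a i<j) b)
  ... | tri> _ _ a | tri≈ _ _ _ = s≤s i<j
  ... | tri> _ _ a | tri> _ _ _ = s≤s i<j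

  punchIn-bounded : ∀ p {i n} → i < n → punchIn p i < suc n
  punchIn-bounded p {i} i<n with ℕ.<-cmp i p
  ... | tri< _ _ _ = ℕ.<-trans i<n (ℕ.n<1+n _)
  ... | tri≈ _ _ _ = s≤s i<n
  ... | tri> _ _ _ = s≤s i<n

  punchOut-bounded : ∀ {p i n} → i < suc n → i ≢ p → p ≤ n → punchOut p i < n
  punchOut-bounded {p} {i} i<1+n i≢p p≤n with ℕ.<-cmp i p
  ... | tri< i<p _ _ = ℕ.<-≤-trans i<p p≤n
  ... | tri≈ _ i≡p _ = ⊥-elim (i≢p i≡p)
  ... | tri> _ _ (s≤s _) = ℕ.≤-pred i<1+n

  punchOut-mono : ∀ p {i j} → i < j → i ≢ p → j ≢ p → punchOut p i < punchOut p j
  punchOut-mono p {i} {j} i<j ni nj with ℕ.<-cmp i p | ℕ.<-cmp j p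
  ... | tri< a _ _ | tri< b _ _ = i<j
  ... | tri< a _ _ | tri≈ _ b _ = ⊥-elim (nj b)
  ... | tri< a _ _ | tri> _ _ c = ℕ.<-≤-trans a (ℕ.<⇒≤pred c)
  ... | tri≈ _ b _ | _ = ⊥-elim (ni b)
  ... | tri> _ _ c | tri< b _ _ = ⊥-elim (ℕ.<-asym (ℕ.<-trans c i<j) b)
  ... | tri> _ _ c | tri≈ _ b _ = ⊥-elim (nj b)
  ... | tri> _ _ c | tri> _ _ d = predlt c i<j
    where predlt : ∀ {q x y} → q < x → x < y → pred x < pred y
          predlt {x = suc x} {suc y} _ (s≤s h) = h


  insertMax-! : ∀ {p σ n i} → i < suc n → insertMax p σ n ! i ≡ insertEntry p n σ i
  insertMax-! {p} {σ} {n} {i} = applyUpTo-! (insertEntry p n σ) (suc n) i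

  removeAt-! : ∀ {p π n i} → i < n → removeAt p π n ! i ≡ π ! punchIn p i
  removeAt-! {p} {π} {n} {i} = applyUpTo-! (λ i → π ! punchIn p i) n i

  module InsertMax {n σ p} (σ-avoids : Avoider n σ) (p≤n : p ≤ n) where
    open Avoider σ-avoids

    π = insertMax p σ n

    data Entry (i : ℕ) : Set where
      new : i ≡ p → π ! i ≡ n → Entry i
      old : i ≢ p → π ! i ≡ σ ! punchOut p i → punchOut p i < n → Entry i

    entry : ∀ i → i < suc n → Entry i
    entry i i< with i ℕ.≟ p
    ... | yes refl = new refl (trans (insertMax-! i<) (insertEntry-at {p} {n} {σ}))
    ... | no i≢p = old i≢p (trans (insertMax-! i<) (insertEntry-off i≢p)) (punchOut-bounded i< i≢p p≤n)

    insertMax-bounded : ∀ i → i < suc n → π ! i < suc n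
    insertMax-bounded i i< with entry i i<
    ... | new _ πi≡n = subst (_< suc n) (sym πi≡n) (ℕ.n<1+n n)
    ... | old _ πi≡ i′<n = subst (_< suc n) (sym πi≡) (ℕ.<-trans (bounded _ i′<n) (ℕ.n<1+n n))

    punchOut-injective : ∀ {i j} → i ≢ p → j ≢ p → punchOut p i ≡ punchOut p j → i ≡ j
    punchOut-injective {i} {j} i≢p j≢p same with ℕ.<-cmp i j
    ... | tri< i<j _ _ = ⊥-elim (ℕ.<-irrefl same (punchOut-mono p i<j i≢p j≢p))
    ... | tri≈ _ i≡j _ = i≡j
    ... | tri> _ _ j<i = ⊥-elim (ℕ.<-irrefl (sym same) (punchOut-mono p j<i j≢p i≢p))

    insertMax-injective : ∀ i j → i < suc n → j < suc n → π ! i ≡ π ! j → i ≡ j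
    insertMax-injective i j i< j< same with entry i i< | entry j j<
    ... | new i≡p _ | new j≡p _ = trans i≡p (sym j≡p)
    ... | new _ πi≡n | old _ πj≡ j′<n = ⊥-elim (ℕ.<-irrefl (trans (sym πj≡) (trans (sym same) πi≡n)) (bounded _ j′<n))
    ... | old _ πi≡ i′<n | new _ πj≡n = ⊥-elim (ℕ.<-irrefl (trans (sym πi≡) (trans same πj≡n)) (bounded _ i′<n))
    ... | old i≢p πi≡ i′<n | old j≢p πj≡ j′<n =
      punchOut-injective i≢p j≢p (injective _ _ i′<n j′<n (trans (sym πi≡) (trans same πj≡)))

    -- A 321 pattern through the new maximum n would need a descent of σ after position p.
    insertMax-Avoider : IncreasingFrom σ n p → Avoider (suc n) π
    insertMax-Avoider increasing =
      avoider (List.length-applyUpTo (insertEntry p n σ) (suc n)) insertMax-bounded insertMax-injective no321′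
      where
      no321′ : ∀ i j l → i < j → j < l → l < suc n → π ! j < π ! i → π ! l < π ! j → ⊥
      no321′ i j l i<j j<l l< πj<πi πl<πj
        with entry i (ℕ.<-trans i<j (ℕ.<-trans j<l l<)) | entry j (ℕ.<-trans j<l l<) | entry l l<
      ... | _ | new _ πj≡n | _ =
        ℕ.<⇒≱ (subst (_< _) πj≡n πj<πi) (ℕ.≤-pred (insertMax-bounded i (ℕ.<-trans i<j (ℕ.<-trans j<l l<))))
      ... | _ | _ | new _ πl≡n = ℕ.<⇒≱ (subst (_< _) πl≡n πl<πj) (ℕ.≤-pred (insertMax-bounded j (ℕ.<-trans j<l l<)))
      ... | new refl _ | old j≢p πj≡ j′<n | old l≢p πl≡ l′<n =
        ℕ.<-asym (subst₂ _<_ (sym πj≡) (sym πl≡) (IncreasingFrom⇒< {σ} increasing (punchOut p j) (punchOut p l)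
          (ℕ.≤-pred (subst (p <_) (sym (suc-punchOut-above i<j)) i<j))
          (punchOut-mono p j<l j≢p l≢p) l′<n)) πl<πj
      ... | old i≢p πi≡ _ | old j≢p πj≡ _ | old l≢p πl≡ l′<n =
        no321 _ _ _ (punchOut-mono p i<j i≢p j≢p) (punchOut-mono p j<l j≢p l≢p) l′<n
          (subst₂ _<_ πj≡ πi≡ πj<πi) (subst₂ _<_ πl≡ πj≡ πl<πj)

    insertMax-position : ∀ q → q < suc n → π ! q ≡ n → q ≡ p
    insertMax-position q q< πq≡n with entry q q<
    ... | new q≡p _ = q≡p
    ... | old _ πq≡ q′<n = ⊥-elim (ℕ.<-irrefl (trans (sym πq≡) πq≡n) (bounded _ q′<n))

    removeAt-insertMax : removeAt p π n ≡ σ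
    removeAt-insertMax = !-ext _ _ (trans (List.length-applyUpTo _ n) (sym length≡)) λ i i< →
      let i<n = subst (i <_) (List.length-applyUpTo _ n) i< in begin
        removeAt p π n ! i                ≡⟨ removeAt-! {p} {π} {n} i<n ⟩
        π ! punchIn p i                   ≡⟨ insertMax-! (punchIn-bounded p i<n) ⟩
        insertEntry p n σ (punchIn p i)   ≡⟨ insertEntry-off (punchIn≢ p i) ⟩
        σ ! punchOut p (punchIn p i)      ≡⟨ cong (σ !_) (punchOut-punchIn p i) ⟩
        σ ! i                             ∎

    runStart-insertMax-inner : p < n → IncreasingFrom σ n p → runStart π (suc n) ≡ suc p
    runStart-insertMax-inner p<n increasing = runStart-unique π (suc n) (suc p) increasing′ not-before
      where
      increasing′ : IncreasingFrom π (suc n) (suc p)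
      increasing′ j j< p<j 1+j< with entry j j< | entry (suc j) 1+j<
      ... | new j≡p _ | _ = ⊥-elim (ℕ.<-irrefl (sym j≡p) p<j)
      ... | _ | new 1+j≡p _ = ⊥-elim (ℕ.<-irrefl (sym 1+j≡p) (ℕ.<-trans p<j (ℕ.n<1+n j)))
      ... | old _ πj≡ j′<n | old _ π1+j≡ 1+j′<n = subst₂ _<_ (sym πj≡) (sym π1+j≡)
          (subst (λ k → σ ! punchOut p j < σ ! k) consecutive
            (increasing (punchOut p j) j′<n (ℕ.≤-pred (subst (p <_) (sym (suc-punchOut-above p<j)) p<j))
              (subst (_< n) (sym consecutive) 1+j′<n)))
        where
        consecutive : suc (punchOut p j) ≡ punchOut p (suc j)
        consecutive = trans (suc-punchOut-above p<j)
          (sym (ℕ.suc-injective (suc-punchOut-above (ℕ.<-trans p<j (ℕ.n<1+n j)))))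
      not-before : ∀ q → q < suc p → ¬ IncreasingFrom π (suc n) q
      not-before q q≤p increasing-q with entry p (s≤s p≤n) | entry (suc p) (s≤s p<n)
      ... | old p≢p _ _ | _ = p≢p refl
      ... | _ | new 1+p≡p _ = ℕ.<-irrefl (sym 1+p≡p) (ℕ.n<1+n p)
      ... | new _ πp≡n | old _ π1+p≡ p′<n =
        ℕ.<-asym (subst₂ _<_ πp≡n π1+p≡ (increasing-q p (s≤s p≤n) (ℕ.≤-pred q≤p) (s≤s p<n))) (bounded _ p′<n)

  module InsertMaxAtEnd {n σ} (σ-avoids : Avoider n σ) where
    open Avoider σ-avoids
    open InsertMax σ-avoids ℕ.≤-refl using (π)

    runStart-insertMax-end : runStart π (suc n) ≡ runStart σ n
    runStart-insertMax-end = runStart-unique π (suc n) (runStart σ n) increasing not-before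
      where
      unchanged : ∀ j → j < n → π ! j ≡ σ ! j
      unchanged j j<n = trans (insertMax-! (ℕ.<-trans j<n (ℕ.n<1+n n)))
        (trans (insertEntry-off (ℕ.<⇒≢ j<n)) (cong (σ !_) (punchOut-below j<n)))
      increasing : IncreasingFrom π (suc n) (runStart σ n)
      increasing j j< t≤j 1+j< with ℕ.m<1+n⇒m<n∨m≡n 1+j<
      ... | inj₁ 1+j<n = subst₂ _<_ (sym (unchanged j (ℕ.<-trans (ℕ.n<1+n j) 1+j<n))) (sym (unchanged (suc j) 1+j<n))
                           (runStart-increasing σ n j (ℕ.<-trans (ℕ.n<1+n j) 1+j<n) t≤j 1+j<n)
      ... | inj₂ refl = subst₂ _<_ (sym (unchanged j (ℕ.n<1+n j)))
                          (sym (trans (insertMax-! {n} {σ} {n} (ℕ.n<1+n n)) (insertEntry-at {n} {n} {σ})))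
                          (bounded j (ℕ.n<1+n j))
      not-before : ∀ q → q < runStart σ n → ¬ IncreasingFrom π (suc n) q
      not-before q q<t increasing-q = runStart-least σ n q q<t (λ j j<n q≤j 1+j<n →
        subst₂ _<_ (unchanged j j<n) (unchanged (suc j) 1+j<n)
          (increasing-q j (ℕ.<-trans j<n (ℕ.n<1+n n)) q≤j (ℕ.<-trans 1+j<n (ℕ.n<1+n n))))

  module RemoveMax {n π p} (π-avoids : Avoider (suc n) π) (p< : p < suc n) (πp≡n : π ! p ≡ n) where
    open Avoider π-avoids

    σ = removeAt p π n

    σ-! : ∀ {i} → i < n → σ ! i ≡ π ! punchIn p i
    σ-! = removeAt-! {p} {π} {n}

    punchIn-entry< : ∀ i → i < n → π ! punchIn p i < n
    punchIn-entry< i i<n = ℕ.≤∧≢⇒< (ℕ.≤-pred (bounded _ (punchIn-bounded p i<n)))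
      (λ πi≡n → punchIn≢ p i (injective _ _ (punchIn-bounded p i<n) p< (trans πi≡n (sym πp≡n))))

    punchIn-injective : ∀ i j → punchIn p i ≡ punchIn p j → i ≡ j
    punchIn-injective i j same with ℕ.<-cmp i j
    ... | tri< i<j _ _ = ⊥-elim (ℕ.<-irrefl same (punchIn-mono p i<j))
    ... | tri≈ _ i≡j _ = i≡j
    ... | tri> _ _ j<i = ⊥-elim (ℕ.<-irrefl (sym same) (punchIn-mono p j<i))

    removeAt-Avoider : Avoider n σ
    removeAt-Avoider = avoider (List.length-applyUpTo _ n)
      (λ i i< → subst (_< n) (sym (σ-! i<)) (punchIn-entry< i i<))
      (λ i j i< j< same → punchIn-injective i j (injective _ _ (punchIn-bounded p i<) (punchIn-bounded p j<)
        (trans (sym (σ-! i<)) (trans same (σ-! j<)))))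
      (λ i j l i<j j<l l<n σj<σi σl<σj → no321 _ _ _ (punchIn-mono p i<j) (punchIn-mono p j<l) (punchIn-bounded p l<n)
         (subst₂ _<_ (σ-! (ℕ.<-trans j<l l<n)) (σ-! (ℕ.<-trans i<j (ℕ.<-trans j<l l<n))) σj<σi)
         (subst₂ _<_ (σ-! l<n) (σ-! (ℕ.<-trans j<l l<n)) σl<σj))

    -- A descent of σ after position p would form a 321 pattern with the maximum π ! p.
    removeAt-increasing : IncreasingFrom σ n p
    removeAt-increasing j j<n p≤j 1+j<n with ℕ.<-cmp (σ ! j) (σ ! suc j)
    ... | tri< σj<σ1+j _ _ = σj<σ1+j
    ... | tri≈ _ same _ = ⊥-elim (ℕ.<-irrefl (Avoider.injective removeAt-Avoider j (suc j) j<n 1+j<n same) (ℕ.n<1+n j))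
    ... | tri> _ _ σ1+j<σj = ⊥-elim (no321 p (suc j) (suc (suc j)) (s≤s p≤j) (ℕ.n<1+n _) (s≤s 1+j<n)
           (subst₂ _<_ (cong (π !_) (punchIn-above p≤j)) (sym πp≡n) (punchIn-entry< j j<n))
           (subst₂ _<_ σ1+j≡ σj≡ σ1+j<σj))
      where
      σj≡ : σ ! j ≡ π ! suc j
      σj≡ = trans (σ-! j<n) (cong (π !_) (punchIn-above p≤j))
      σ1+j≡ : σ ! suc j ≡ π ! suc (suc j)
      σ1+j≡ = trans (σ-! 1+j<n) (cong (π !_) (punchIn-above (ℕ.≤-trans p≤j (ℕ.n≤1+n j))))

    insertMax-removeAt : insertMax p σ n ≡ π
    insertMax-removeAt = !-ext _ _ (trans (List.length-applyUpTo (insertEntry p n σ) (suc n)) (sym length≡)) λ i i< →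
      let i<1+n = subst (i <_) (List.length-applyUpTo (insertEntry p n σ) (suc n)) i< in
      trans (insertMax-! i<1+n) (entry i i<1+n)
      where
      entry : ∀ i → i < suc n → insertEntry p n σ i ≡ π ! i
      entry i i< = by-cases (i ℕ.≟ p)
        where
        by-cases : Dec (i ≡ p) → insertEntry p n σ i ≡ π ! i
        by-cases (yes i≡p) = trans (cong (insertEntry p n σ) i≡p)
          (trans (insertEntry-at {p} {n} {σ}) (trans (sym πp≡n) (cong (π !_) (sym i≡p))))
        by-cases (no i≢p) = trans (insertEntry-off i≢p)
          (trans (σ-! (punchOut-bounded i< i≢p (ℕ.≤-pred p<))) (cong (π !_) (punchIn-punchOut i≢p)))


module GeneratingTree where

  open import Defs using (ΣZ; catalan)
  open import Data.Nat as ℕ using (ℕ; zero; suc; _<_; _≤_; s≤s; _∸_)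
  import Data.Nat.Properties as ℕ
  open import Data.Integer using (ℤ; +_; _+_; 1ℤ)
  import Data.Integer.Properties as ℤ
  open import Data.Product using (_,_; proj₁; proj₂; _×_)
  open import Data.List using (List; map; concatMap)
  open import Data.List.Membership.Propositional using (_∈_; find)
  open import Data.List.Membership.Propositional.Properties
  open import Data.List.Relation.Unary.Any as Any using ()
  open import Data.List.Relation.Unary.Unique.Propositional using (Unique)
  open import Data.List.Relation.Binary.Permutation.Propositional using (_↭_)
  open import Relation.Binary.PropositionalEquality as ≡ using (_≡_; refl; sym; trans; cong; cong₂; subst)
  open ≡.≡-Reasoning
  open IntegerListSum
  open UniqueList
  open RangeSum
  open Range
  open Avoiders
  open AvoiderStructure using (max-position)
  open Insertion
  open Ballot using (ballot; Σ<-pos; catalan≡ballot)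

  -- Inserting the new maximum n at position p keeps σ 321-avoiding exactly when p ≥ runStart σ n,
  -- and every avoider of length n + 1 arises in exactly one way (remove its maximum).
  activeSites : List ℕ → ℕ → List ℕ
  activeSites σ n = range (runStart σ n) (suc n ∸ runStart σ n)

  children : ℕ → List (List ℕ)
  children n = concatMap (λ σ → map (λ p → insertMax p σ n) (activeSites σ n)) (avoiders n)

  private
    runStart+sites≡1+n : ∀ σ n → runStart σ n ℕ.+ (suc n ∸ runStart σ n) ≡ suc n
    runStart+sites≡1+n σ n = ℕ.m+[n∸m]≡n (ℕ.≤-trans (runStart≤ σ n) (ℕ.n≤1+n n))

  ∈-activeSites⁻ : ∀ σ n {p} → p ∈ activeSites σ n → runStart σ n ≤ p × p < suc n
  ∈-activeSites⁻ σ n {p} p∈ with ∈-range⁻ p∈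
  ... | t≤p , p<end = t≤p , subst (p <_) (runStart+sites≡1+n σ n) p<end

  ∈-activeSites⁺ : ∀ σ n {p} → runStart σ n ≤ p → p < suc n → p ∈ activeSites σ n
  ∈-activeSites⁺ σ n {p} t≤p p<1+n = ∈-range⁺ t≤p (subst (p <_) (sym (runStart+sites≡1+n σ n)) p<1+n)

  insertMax-at : ∀ {p σ n} → p < suc n → insertMax p σ n ! p ≡ n
  insertMax-at {p} {σ} {n} p< = trans (insertMax-! {p} {σ} {n} p<) (insertEntry-at {p} {n} {σ})

  children-unique : ∀ n → Unique (children n)
  children-unique n = Unique-concatMap _ (avoiders n) (avoiders-unique n)
    (λ σ σ∈ → Unique-map _ (activeSites σ n) (λ p q p∈ q∈ same → max-at σ σ (sym same) σ∈ (site< σ q∈) (site< σ p∈))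
      (range-unique _ _))
    same-parent
    where
    site< : ∀ σ {p} → p ∈ activeSites σ n → p < suc n
    site< σ p∈ = proj₂ (∈-activeSites⁻ σ n p∈)

    max-at : ∀ σ σ′ {p q} → insertMax q σ′ n ≡ insertMax p σ n → σ′ ∈ avoiders n → q < suc n → p < suc n → p ≡ q
    max-at σ σ′ {p} {q} same σ′∈ q<1+n p<1+n = InsertMax.insertMax-position (∈-avoiders⁻ σ′∈) (ℕ.≤-pred q<1+n) p p<1+n
      (trans (cong (_! p) same) (insertMax-at {p} {σ} {n} p<1+n))

    same-parent : ∀ σ σ′ π → σ ∈ avoiders n → σ′ ∈ avoiders n → π ∈ map (λ p → insertMax p σ n) (activeSites σ n) →
                  π ∈ map (λ p → insertMax p σ′ n) (activeSites σ′ n) → σ ≡ σ′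
    same-parent σ σ′ π σ∈ σ′∈ π∈ π∈′
      with ∈-map⁻ (λ p → insertMax p σ n) π∈ | ∈-map⁻ (λ p → insertMax p σ′ n) π∈′
    ... | p , p∈ , refl | p′ , p′∈ , same with max-at σ σ′ (sym same) σ′∈ (site< σ′ p′∈) (site< σ p∈)
    ... | refl = begin
      σ                                ≡⟨ sym (InsertMax.removeAt-insertMax (∈-avoiders⁻ σ∈) (ℕ.≤-pred (site< σ p∈))) ⟩
      removeAt p (insertMax p σ n) n   ≡⟨ cong (λ π → removeAt p π n) same ⟩
      removeAt p (insertMax p σ′ n) n  ≡⟨ InsertMax.removeAt-insertMax (∈-avoiders⁻ σ′∈) (ℕ.≤-pred (site< σ p∈)) ⟩
      σ′                               ∎

  ∈-children⁻ : ∀ {n π} → π ∈ children n → Avoider (suc n) π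
  ∈-children⁻ {n} π∈ with find (∈-concatMap⁻ (λ σ → map (λ p → insertMax p σ n) (activeSites σ n)) {xs = avoiders n} π∈)
  ... | σ , σ∈ , π∈′ with ∈-map⁻ (λ p → insertMax p σ n) π∈′
  ... | p , p∈ , refl = InsertMax.insertMax-Avoider (∈-avoiders⁻ σ∈) (ℕ.≤-pred (proj₂ (∈-activeSites⁻ σ n p∈)))
          (IncreasingFrom-mono {σ = σ} {n = n} (proj₁ (∈-activeSites⁻ σ n p∈)) (runStart-increasing σ n))

  ∈-children⁺ : ∀ {n π} → Avoider (suc n) π → π ∈ children n
  ∈-children⁺ {n} {π} π-avoids with max-position π-avoids
  ... | p , p<1+n , πp≡n = subst (_∈ children n) (RemoveMax.insertMax-removeAt π-avoids p<1+n πp≡n)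
     (∈-concatMap⁺ (λ σ → map (λ p → insertMax p σ n) (activeSites σ n)) {xs = avoiders n}
       (Any.map (λ { refl → ∈-map⁺ (λ q → insertMax q σ n) p∈ })
         (∈-avoiders⁺ (RemoveMax.removeAt-Avoider π-avoids p<1+n πp≡n))))
    where
    σ = removeAt p π n
    p∈ : p ∈ activeSites σ n
    p∈ = ∈-activeSites⁺ σ n (runStart-minimal σ n p (RemoveMax.removeAt-increasing π-avoids p<1+n πp≡n)) p<1+n

  avoiders↭children : ∀ n → avoiders (suc n) ↭ children n
  avoiders↭children n = unique-↭ (avoiders-unique (suc n)) (children-unique n)
    (λ π∈ → ∈-children⁺ (∈-avoiders⁻ π∈)) (λ π∈ → ∈-avoiders⁺ (∈-children⁻ π∈))

  #activeSites : ℕ → List ℕ → ℕ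
  #activeSites n σ = suc n ∸ runStart σ n

  siteSum : ℕ → (ℕ → ℤ) → ℤ
  siteSum n h = ΣZ (map (λ σ → h (#activeSites n σ)) (avoiders n))

  private
    1+n∸[t+i]≡2+[n∸t∸[1+i]] : ∀ n t i → t ℕ.+ i < n → suc n ∸ (t ℕ.+ i) ≡ suc (suc ((n ∸ t) ∸ suc i))
    1+n∸[t+i]≡2+[n∸t∸[1+i]] (suc n) zero zero _ = refl
    1+n∸[t+i]≡2+[n∸t∸[1+i]] (suc n) zero (suc i) (s≤s t+i<n) = 1+n∸[t+i]≡2+[n∸t∸[1+i]] n zero i t+i<n
    1+n∸[t+i]≡2+[n∸t∸[1+i]] (suc n) (suc t) i (s≤s t+i<n) = 1+n∸[t+i]≡2+[n∸t∸[1+i]] n t i t+i<n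

    2+n∸t≡2+[n∸t] : ∀ n t → t ≤ n → suc (suc n) ∸ t ≡ suc (suc (n ∸ t))
    2+n∸t≡2+[n∸t] n zero _ = refl
    2+n∸t≡2+[n∸t] (suc n) (suc t) (s≤s t≤n) = 2+n∸t≡2+[n∸t] n t t≤n

  -- Inserting at runStart σ n + i < n gives a child whose final run starts at runStart σ n + i + 1;
  -- inserting at the end keeps the final run, which now has one more active site.
  ΣZ-activeSites : ∀ n σ → Avoider n σ → (h : ℕ → ℤ) →
    ΣZ (map (λ p → h (#activeSites (suc n) (insertMax p σ n))) (activeSites σ n)) ≡ Σ< (#activeSites n σ) (λ i → h (suc (suc i)))
  ΣZ-activeSites n σ σ-avoids h = begin
    ΣZ (map F (activeSites σ n))                    ≡⟨ ΣZ-range F t (suc n ∸ t) ⟩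
    Σ< (suc n ∸ t) (λ i → F (t ℕ.+ i))              ≡⟨ cong (λ l → Σ< l (λ i → F (t ℕ.+ i))) 1+n∸t≡1+d ⟩
    Σ< d (λ i → F (t ℕ.+ i)) + F (t ℕ.+ d)          ≡⟨ cong₂ _+_ inner end ⟩
    Σ< d (λ i → h (suc (suc i))) + h (suc (suc d))  ≡⟨ cong (λ l → Σ< l (λ i → h (suc (suc i)))) (sym 1+n∸t≡1+d) ⟩
    Σ< (suc n ∸ t) (λ i → h (suc (suc i)))          ∎
    where
    t = runStart σ n
    d = n ∸ t
    F : ℕ → ℤ
    F p = h (#activeSites (suc n) (insertMax p σ n))
    1+n∸t≡1+d : suc n ∸ t ≡ suc d
    1+n∸t≡1+d = ℕ.+-∸-assoc 1 (runStart≤ σ n)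
    t+d≡n : t ℕ.+ d ≡ n
    t+d≡n = ℕ.m+[n∸m]≡n (runStart≤ σ n)
    inner : Σ< d (λ i → F (t ℕ.+ i)) ≡ Σ< d (λ i → h (suc (suc i)))
    inner = trans (Σ<-cong d (λ i i<d → cong h (sites i i<d))) (Σ<-reverse d (λ j → h (suc (suc j))))
      where
      sites : ∀ i → i < d → #activeSites (suc n) (insertMax (t ℕ.+ i) σ n) ≡ suc (suc (d ∸ suc i))
      sites i i<d = trans
        (cong (suc (suc n) ∸_) (InsertMax.runStart-insertMax-inner σ-avoids (ℕ.<⇒≤ t+i<n) t+i<n
          (IncreasingFrom-mono {σ = σ} {n = n} (ℕ.m≤m+n t i) (runStart-increasing σ n))))
        (1+n∸[t+i]≡2+[n∸t∸[1+i]] n t i t+i<n)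
        where t+i<n = subst (t ℕ.+ i <_) t+d≡n (ℕ.+-monoʳ-< t i<d)
    end : F (t ℕ.+ d) ≡ h (suc (suc d))
    end = cong h (trans (cong (λ p → #activeSites (suc n) (insertMax p σ n)) t+d≡n)
      (trans (cong (suc (suc n) ∸_) (InsertMaxAtEnd.runStart-insertMax-end σ-avoids)) (2+n∸t≡2+[n∸t] n t (runStart≤ σ n))))

  siteSum-cong : ∀ n {h h′ : ℕ → ℤ} → (∀ k → h k ≡ h′ k) → siteSum n h ≡ siteSum n h′
  siteSum-cong n h≡h′ = ΣZ-cong (avoiders n) (λ σ _ → h≡h′ _)

  siteSum-suc : ∀ n h → siteSum (suc n) h ≡ siteSum n (λ k → Σ< k (λ i → h (suc (suc i))))
  siteSum-suc n h = begin
    ΣZ (map F (avoiders (suc n)))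
      ≡⟨ ΣZ-↭ F (avoiders↭children n) ⟩
    ΣZ (map F (children n))
      ≡⟨ ΣZ-concatMap F _ (avoiders n) ⟩
    ΣZ (map (λ σ → ΣZ (map F (map (λ p → insertMax p σ n) (activeSites σ n)))) (avoiders n))
      ≡⟨ ΣZ-cong (avoiders n) (λ σ σ∈ → trans (ΣZ-map F (λ p → insertMax p σ n) (activeSites σ n))
           (ΣZ-activeSites n σ (∈-avoiders⁻ σ∈) h)) ⟩
    siteSum n (λ k → Σ< k (λ i → h (suc (suc i)))) ∎
    where F = λ π → h (#activeSites (suc n) π)

  siteSum-ballot : ∀ n m → siteSum n (λ k → + ballot m k) ≡ + ballot (n ℕ.+ m) 1
  siteSum-ballot zero m = ℤ.+-identityʳ _
  siteSum-ballot (suc n) m = begin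
    siteSum (suc n) (λ k → + ballot m k)
      ≡⟨ siteSum-suc n (λ k → + ballot m k) ⟩
    siteSum n (λ k → Σ< k (λ i → + ballot m (suc (suc i))))
      ≡⟨ siteSum-cong n (λ k → Σ<-pos k (λ i → ballot m (suc (suc i)))) ⟩
    siteSum n (λ k → + ballot (suc m) k)
      ≡⟨ siteSum-ballot n (suc m) ⟩
    + ballot (n ℕ.+ suc m) 1
      ≡⟨ cong (λ l → + ballot l 1) (ℕ.+-suc n m) ⟩
    + ballot (suc n ℕ.+ m) 1 ∎

  #avoiders : ℕ → ℤ
  #avoiders n = ΣZ (map (λ _ → 1ℤ) (avoiders n))

  #avoiders≡catalan : ∀ n → #avoiders n ≡ + catalan n
  #avoiders≡catalan n = begin
    siteSum n (λ k → + ballot 0 k)   ≡⟨ siteSum-ballot n 0 ⟩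
    + ballot (n ℕ.+ 0) 1             ≡⟨ cong (λ l → + ballot l 1) (ℕ.+-identityʳ n) ⟩
    + ballot n 1                     ≡⟨ cong +_ (sym (catalan≡ballot n)) ⟩
    + catalan n                      ∎


module GeometricSum where

  open import Function using (_∘_)
  open import Data.Nat as ℕ using (ℕ; zero; suc; _<_; z≤n; s≤s; _∸_)
  open import Data.Bool using (Bool; true; false; if_then_else_)
  open import Data.Integer using (ℤ; _+_; _*_; _-_; _^_; 0ℤ; 1ℤ)
  open import Data.Integer.Properties using (+-comm; +-identityˡ; *-zeroʳ)
  open import Data.Integer.Tactic.RingSolver using (solve-∀)
  open import Relation.Binary.PropositionalEquality as ≡ using (_≡_; refl; sym; cong; cong₂)
  open ≡.≡-Reasoning
  open RangeSum

  count : (ℕ → Bool) → ℕ → ℕ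
  count p zero = 0
  count p (suc n) = (if p 0 then 1 else 0) ℕ.+ count (p ∘ suc) n

  count-cong : ∀ n {p q : ℕ → Bool} → (∀ i → i < n → p i ≡ q i) → count p n ≡ count q n
  count-cong zero h = refl
  count-cong (suc n) h =
    cong₂ ℕ._+_ (cong (λ b → if b then 1 else 0) (h 0 (s≤s z≤n))) (count-cong n (λ i i< → h (suc i) (s≤s i<)))

  geometric : ℤ → ℕ → ℤ
  geometric x f = Σ< f (x ^_)

  ^≡1+[x-1]*geometric : ∀ x f → x ^ f ≡ 1ℤ + (x - 1ℤ) * geometric x f
  ^≡1+[x-1]*geometric x zero = sym (cong (1ℤ +_) (*-zeroʳ (x - 1ℤ)))
  ^≡1+[x-1]*geometric x (suc f) = begin
    x * x ^ f                                    ≡⟨ peel x (x ^ f) ⟩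
    x ^ f + (x - 1ℤ) * x ^ f                     ≡⟨ cong (_+ (x - 1ℤ) * x ^ f) (^≡1+[x-1]*geometric x f) ⟩
    (1ℤ + (x - 1ℤ) * G) + (x - 1ℤ) * x ^ f       ≡⟨ collect x G (x ^ f) ⟩
    1ℤ + (x - 1ℤ) * (G + x ^ f)                  ∎
    where
    G = geometric x f
    peel : ∀ x p → x * p ≡ p + (x - 1ℤ) * p
    peel = solve-∀
    collect : ∀ x g p → (1ℤ + (x - 1ℤ) * g) + (x - 1ℤ) * p ≡ 1ℤ + (x - 1ℤ) * (g + p)
    collect = solve-∀

  when : Bool → ℤ → ℤ
  when b z = if b then z else 0ℤ

  -- The term x ^ j of the geometric sum is contributed by the marked point with exactly j marked points after it.
  geometric-count : ∀ x (p : ℕ → Bool) n →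
    geometric x (count p n) ≡ Σ< n (λ i → when (p i) (x ^ count (λ k → p (suc i ℕ.+ k)) (n ∸ suc i)))
  geometric-count x p zero = refl
  geometric-count x p (suc n) = begin
    geometric x (count p (suc n))
      ≡⟨ first (p 0) ⟩
    when (p 0) (x ^ count (p ∘ suc) n) + geometric x (count (p ∘ suc) n)
      ≡⟨ cong (when (p 0) (x ^ count (p ∘ suc) n) +_) (geometric-count x (p ∘ suc) n) ⟩
    when (p 0) (x ^ count (p ∘ suc) n) + Σ< n (λ i → when (p (suc i)) (x ^ count (λ k → p (suc (suc i) ℕ.+ k)) (n ∸ suc i)))
      ≡⟨ sym (Σ<-sucˡ n _) ⟩
    Σ< (suc n) (λ i → when (p i) (x ^ count (λ k → p (suc i ℕ.+ k)) (suc n ∸ suc i))) ∎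
    where
    first : ∀ b → geometric x ((if b then 1 else 0) ℕ.+ count (p ∘ suc) n)
                  ≡ when b (x ^ count (p ∘ suc) n) + geometric x (count (p ∘ suc) n)
    first true = +-comm (geometric x (count (p ∘ suc) n)) (x ^ count (p ∘ suc) n)
    first false = sym (+-identityˡ _)


module FixedPointSplitting where

  open import Data.Nat as ℕ using (ℕ; zero; suc; _<_; s≤s; _+_; _∸_; _≡ᵇ_)
  import Data.Nat.Properties as ℕ
  open import Data.Product using (_,_; proj₁; proj₂; _×_; ∃)
  open import Data.List using (List; map; concatMap; filter; applyUpTo; length)
  open import Data.List.Properties using (length-applyUpTo)
  open import Data.List.Membership.Propositional using (_∈_; find)
  open import Data.List.Membership.Propositional.Properties
  open import Data.List.Relation.Unary.Any as Any using ()
  open import Data.List.Relation.Unary.Unique.Propositional using (Unique)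
  import Data.List.Relation.Unary.Unique.Propositional.Properties as Unique
  open import Data.List.Relation.Binary.Permutation.Propositional using (_↭_)
  open import Relation.Binary.PropositionalEquality as ≡ using (_≡_; refl; sym; trans; cong; subst; subst₂)
  open import Data.Empty using (⊥; ⊥-elim)
  open import Relation.Binary using (tri<; tri≈; tri>)
  open UniqueList
  open Avoiders
  open AvoiderStructure using (module FixedPoint)
  open GeometricSum using (count; count-cong)
  open ≡.≡-Reasoning

  directSumEntry : ℕ → List ℕ → List ℕ → ℕ → ℕ
  directSumEntry m σ τ j with ℕ.<-cmp j m
  ... | tri< _ _ _ = σ ! j
  ... | tri≈ _ _ _ = m
  ... | tri> _ _ _ = suc m + τ ! (j ∸ suc m)

  directSumEntry-below : ∀ {m σ τ j} → j < m → directSumEntry m σ τ j ≡ σ ! j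
  directSumEntry-below {m} {σ} {τ} {j} j<m with ℕ.<-cmp j m
  ... | tri< _ _ _ = refl
  ... | tri≈ _ b _ = ⊥-elim (ℕ.<-irrefl b j<m)
  ... | tri> _ _ c = ⊥-elim (ℕ.<-asym j<m c)

  directSumEntry-at : ∀ {m σ τ} → directSumEntry m σ τ m ≡ m
  directSumEntry-at {m} with ℕ.<-cmp m m
  ... | tri< a _ _ = ⊥-elim (ℕ.<-irrefl refl a)
  ... | tri≈ _ _ _ = refl
  ... | tri> _ _ c = ⊥-elim (ℕ.<-irrefl refl c)

  directSumEntry-above : ∀ {m σ τ j} → directSumEntry m σ τ (suc m + j) ≡ suc m + τ ! j
  directSumEntry-above {m} {σ} {τ} {j} with ℕ.<-cmp (suc m + j) m
  ... | tri< a _ _ = ⊥-elim (ℕ.<-asym a (ℕ.m≤m+n (suc m) j))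
  ... | tri≈ _ b _ = ⊥-elim (ℕ.<-irrefl (sym b) (ℕ.m≤m+n (suc m) j))
  ... | tri> _ _ _ = cong (λ z → suc m + τ ! z) (ℕ.m+n∸m≡n (suc m) j)

  -- σ ⊕ 1 ⊕ τ for σ of length m and τ of length k: the fixed point m separates the two blocks.
  directSum : ℕ → ℕ → List ℕ → List ℕ → List ℕ
  directSum m k σ τ = applyUpTo (directSumEntry m σ τ) (suc m + k)

  module DirectSum (m k : ℕ) (σ τ : List ℕ) where
    private
      n = suc m + k
      w = directSum m k σ τ

      w-! : ∀ {j} → j < n → w ! j ≡ directSumEntry m σ τ j
      w-! {j} = applyUpTo-! (directSumEntry m σ τ) n j

    directSum-fixed : w ! m ≡ m
    directSum-fixed = trans (w-! (ℕ.m≤m+n (suc m) k)) (directSumEntry-at {m} {σ} {τ})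

    directSum-below : ∀ j → j < m → w ! j ≡ σ ! j
    directSum-below j j<m = trans (w-! (ℕ.<-trans j<m (ℕ.m≤m+n (suc m) k))) (directSumEntry-below {m} {σ} {τ} j<m)

    directSum-above : ∀ j → j < k → w ! (suc m + j) ≡ suc m + τ ! j
    directSum-above j j<k = trans (w-! (ℕ.+-monoʳ-< (suc m) j<k)) (directSumEntry-above {m} {σ} {τ})

    data Block (j : ℕ) : Set where
      left : j < m → w ! j ≡ σ ! j → Block j
      middle : j ≡ m → w ! j ≡ m → Block j
      right : ∀ j′ → j ≡ suc m + j′ → j′ < k → w ! j ≡ suc m + τ ! j′ → Block j

    block : ∀ j → j < n → Block j
    block j j<n with ℕ.<-cmp j m
    ... | tri< j<m _ _ = left j<m (directSum-below j j<m)
    ... | tri≈ _ refl _ = middle refl directSum-fixed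
    ... | tri> _ _ m<j = right (j ∸ suc m) j≡ j′<k (trans (cong (w !_) j≡) (directSum-above (j ∸ suc m) j′<k))
      where j≡ = sym (ℕ.m+[n∸m]≡n m<j)
            j′<k = ℕ.+-cancelˡ-< (suc m) _ _ (subst (_< n) j≡ j<n)

    m<1+m+ : ∀ t → m < suc m + t
    m<1+m+ t = ℕ.<-≤-trans (ℕ.n<1+n m) (ℕ.m≤m+n (suc m) t)

    directSum-Avoider : Avoider m σ → Avoider k τ → Avoider n w
    directSum-Avoider σ-avoids τ-avoids = avoider (length-applyUpTo (directSumEntry m σ τ) n) bounded′ injective′ no321′
      where
      module σ = Avoider σ-avoids
      module τ = Avoider τ-avoids

      left< : ∀ {j} → j < m → w ! j ≡ σ ! j → w ! j < m
      left< j<m wj≡ = subst (_< m) (sym wj≡) (σ.bounded _ j<m)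

      right> : ∀ {x t} → x ≡ suc m + t → m < x
      right> wj≡ = subst (m <_) (sym wj≡) (m<1+m+ _)

      below-m⇒left : ∀ {j} → Block j → w ! j < m → j < m
      below-m⇒left (left j<m _) _ = j<m
      below-m⇒left (middle _ wj≡m) wj<m = ⊥-elim (ℕ.<-irrefl wj≡m wj<m)
      below-m⇒left (right _ _ _ wj≡) wj<m = ⊥-elim (ℕ.<-asym wj<m (right> wj≡))

      left-entry : ∀ {j} → Block j → j < m → w ! j ≡ σ ! j
      left-entry (left _ wj≡) _ = wj≡
      left-entry (middle j≡m _) j<m = ⊥-elim (ℕ.<-irrefl j≡m j<m)
      left-entry (right _ j≡ _ _) j<m = ⊥-elim (ℕ.<-asym j<m (subst (m <_) (sym j≡) (m<1+m+ _)))

      right-entry : ∀ {j} → Block j → m < j → ∃ λ j′ → j ≡ suc m + j′ × j′ < k × w ! j ≡ suc m + τ ! j′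
      right-entry (left j<m _) m<j = ⊥-elim (ℕ.<-asym j<m m<j)
      right-entry (middle j≡m _) m<j = ⊥-elim (ℕ.<-irrefl (sym j≡m) m<j)
      right-entry (right j′ j≡ j′<k wj≡) _ = j′ , j≡ , j′<k , wj≡

      bounded′ : ∀ j → j < n → w ! j < n
      bounded′ j j<n with block j j<n
      ... | left j<m wj≡ = ℕ.<-trans (left< j<m wj≡) (ℕ.m≤m+n (suc m) k)
      ... | middle _ wj≡m = subst (_< n) (sym wj≡m) (ℕ.m≤m+n (suc m) k)
      ... | right j′ _ j′<k wj≡ = subst (_< n) (sym wj≡) (ℕ.+-monoʳ-< (suc m) (τ.bounded j′ j′<k))

      injective′ : ∀ i j → i < n → j < n → w ! i ≡ w ! j → i ≡ j
      injective′ i j i<n j<n same with block i i<n | block j j<n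
      ... | left i<m wi≡ | left j<m wj≡ = σ.injective i j i<m j<m (trans (sym wi≡) (trans same wj≡))
      ... | middle i≡m _ | middle j≡m _ = trans i≡m (sym j≡m)
      ... | right i′ i≡ i′<k wi≡ | right j′ j≡ j′<k wj≡ =
        trans i≡ (trans (cong (suc m +_) (τ.injective i′ j′ i′<k j′<k
          (ℕ.+-cancelˡ-≡ (suc m) _ _ (trans (sym wi≡) (trans same wj≡))))) (sym j≡))
      ... | left i<m wi≡ | middle _ wj≡m = ⊥-elim (ℕ.<-irrefl (trans same wj≡m) (left< i<m wi≡))
      ... | left i<m wi≡ | right _ _ _ wj≡ = ⊥-elim (ℕ.<-asym (left< i<m wi≡) (subst (m <_) (sym same) (right> wj≡)))
      ... | middle _ wi≡m | left j<m wj≡ = ⊥-elim (ℕ.<-irrefl (trans (sym same) wi≡m) (left< j<m wj≡))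
      ... | middle _ wi≡m | right _ _ _ wj≡ = ⊥-elim (ℕ.<-irrefl (sym (trans (sym same) wi≡m)) (right> wj≡))
      ... | right _ _ _ wi≡ | left j<m wj≡ = ⊥-elim (ℕ.<-asym (left< j<m wj≡) (subst (m <_) same (right> wi≡)))
      ... | right _ _ _ wi≡ | middle _ wj≡m = ⊥-elim (ℕ.<-irrefl (sym (trans same wj≡m)) (right> wi≡))

      -- A 321 pattern cannot straddle the blocks: the entries are < m before m and > m after m.
      no321′ : ∀ a b c → a < b → b < c → c < n → w ! b < w ! a → w ! c < w ! b → ⊥
      no321′ a b c a<b b<c c<n wb<wa wc<wb
        with block a (ℕ.<-trans a<b (ℕ.<-trans b<c c<n)) | block b (ℕ.<-trans b<c c<n) | block c c<n
      ... | left a<m wa≡ | block-b | block-c =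
        σ.no321 a b c a<b b<c c<m (subst₂ _<_ (left-entry block-b b<m) wa≡ wb<wa)
          (subst₂ _<_ (left-entry block-c c<m) (left-entry block-b b<m) wc<wb)
        where
        b<m = below-m⇒left block-b (ℕ.<-trans wb<wa (left< a<m wa≡))
        c<m = below-m⇒left block-c (ℕ.<-trans wc<wb (ℕ.<-trans wb<wa (left< a<m wa≡)))
      ... | middle refl wa≡m | block-b | _ with right-entry block-b a<b
      ...   | _ , _ , _ , wb≡ = ℕ.<-asym (subst (w ! b <_) wa≡m wb<wa) (right> wb≡)
      no321′ a b c a<b b<c c<n wb<wa wc<wb | right a′ refl a′<k wa≡ | block-b | block-c
        with right-entry block-b (ℕ.<-trans (m<1+m+ a′) a<b) | right-entry block-c (ℕ.<-trans (m<1+m+ a′) (ℕ.<-trans a<b b<c))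
      ... | b′ , refl , _ , wb≡ | c′ , refl , c′<k , wc≡ =
        τ.no321 a′ b′ c′ (cancel a<b) (cancel b<c) c′<k
          (cancel (subst₂ _<_ wb≡ wa≡ wb<wa)) (cancel (subst₂ _<_ wc≡ wb≡ wc<wb))
        where cancel : ∀ {x y} → suc m + x < suc m + y → x < y
              cancel = ℕ.+-cancelˡ-< (suc m) _ _

  +-≡ᵇ-cancelˡ : ∀ m x y → (m + x ≡ᵇ m + y) ≡ (x ≡ᵇ y)
  +-≡ᵇ-cancelˡ zero x y = refl
  +-≡ᵇ-cancelˡ (suc m) x y = +-≡ᵇ-cancelˡ m x y

  fixedPointCount : ℕ → List ℕ → ℕ
  fixedPointCount k τ = count (λ j → τ ! j ≡ᵇ j) k

  fixedPointsAfter : ℕ → ℕ → List ℕ → ℕ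
  fixedPointsAfter m k w = count (λ j → w ! (suc m + j) ≡ᵇ suc m + j) k

  fixedPointsAfter-directSum : ∀ m k σ τ → fixedPointsAfter m k (directSum m k σ τ) ≡ fixedPointCount k τ
  fixedPointsAfter-directSum m k σ τ = count-cong k λ j j<k →
    trans (cong (_≡ᵇ suc m + j) (DirectSum.directSum-above m k σ τ j j<k)) (+-≡ᵇ-cancelˡ (suc m) (τ ! j) j)

  directSum-injective : ∀ {m k σ τ σ′ τ′} → length σ ≡ m → length τ ≡ k → length σ′ ≡ m → length τ′ ≡ k →
                        directSum m k σ τ ≡ directSum m k σ′ τ′ → σ ≡ σ′ × τ ≡ τ′
  directSum-injective {m} {k} {σ} {τ} {σ′} {τ′} |σ| |τ| |σ′| |τ′| same =
    !-ext σ σ′ (trans |σ| (sym |σ′|)) (λ j j< → let j<m = subst (j <_) |σ| j< in begin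
      σ ! j                        ≡⟨ sym (DirectSum.directSum-below m k σ τ j j<m) ⟩
      directSum m k σ τ ! j        ≡⟨ cong (_! j) same ⟩
      directSum m k σ′ τ′ ! j      ≡⟨ DirectSum.directSum-below m k σ′ τ′ j j<m ⟩
      σ′ ! j                       ∎) ,
    !-ext τ τ′ (trans |τ| (sym |τ′|)) (λ j j< → let j<k = subst (j <_) |τ| j< in ℕ.+-cancelˡ-≡ (suc m) _ _ (begin
      suc m + τ ! j                      ≡⟨ sym (DirectSum.directSum-above m k σ τ j j<k) ⟩
      directSum m k σ τ ! (suc m + j)    ≡⟨ cong (_! (suc m + j)) same ⟩
      directSum m k σ′ τ′ ! (suc m + j)  ≡⟨ DirectSum.directSum-above m k σ′ τ′ j j<k ⟩
      suc m + τ′ ! j                     ∎))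

  module SplitAtFixedPoint {m k w} (w-avoids : Avoider (suc m + k) w) (fixed : w ! m ≡ m) where
    open Avoider w-avoids
    open FixedPoint w-avoids (ℕ.m≤m+n (suc m) k) fixed

    σ = applyUpTo (w !_) m
    τ = applyUpTo (λ j → w ! (suc m + j) ∸ suc m) k

    right< : ∀ j → j < k → suc m + j < suc m + k
    right< j j<k = ℕ.+-monoʳ-< (suc m) j<k

    σ-! : ∀ j → j < m → σ ! j ≡ w ! j
    σ-! j j<m = applyUpTo-! (w !_) m j j<m

    τ-! : ∀ j → j < k → suc m + τ ! j ≡ w ! (suc m + j)
    τ-! j j<k = trans (cong (suc m +_) (applyUpTo-! (λ j → w ! (suc m + j) ∸ suc m) k j j<k))
      (ℕ.m+[n∸m]≡n (after-fixed-point (suc m + j) (s≤s (ℕ.m≤m+n m j)) (right< j j<k)))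

    σ-avoids : Avoider m σ
    σ-avoids = avoider (length-applyUpTo (w !_) m)
      (λ j j< → subst (_< m) (sym (σ-! j j<)) (before-fixed-point j j<))
      (λ i j i< j< same → injective i j (left< i<) (left< j<) (trans (sym (σ-! i i<)) (trans same (σ-! j j<))))
      (λ a b c a<b b<c c<m σb<σa σc<σb → no321 a b c a<b b<c (left< c<m)
        (subst₂ _<_ (σ-! b (ℕ.<-trans b<c c<m)) (σ-! a (ℕ.<-trans a<b (ℕ.<-trans b<c c<m))) σb<σa)
        (subst₂ _<_ (σ-! c c<m) (σ-! b (ℕ.<-trans b<c c<m)) σc<σb))
      where left< : ∀ {j} → j < m → j < suc m + k
            left< j<m = ℕ.<-trans j<m (ℕ.m≤m+n (suc m) k)

    τ-avoids : Avoider k τ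
    τ-avoids = avoider (length-applyUpTo (λ j → w ! (suc m + j) ∸ suc m) k)
      (λ j j< → ℕ.+-cancelˡ-< (suc m) _ _ (subst (_< suc m + k) (sym (τ-! j j<)) (bounded _ (right< j j<))))
      (λ i j i< j< same → ℕ.+-cancelˡ-≡ (suc m) _ _ (injective _ _ (right< i i<) (right< j j<)
          (trans (sym (τ-! i i<)) (trans (cong (suc m +_) same) (τ-! j j<)))))
      (λ a b c a<b b<c c<k τb<τa τc<τb → no321 _ _ _ (ℕ.+-monoʳ-< (suc m) a<b) (ℕ.+-monoʳ-< (suc m) b<c) (right< c c<k)
        (subst₂ _<_ (τ-! b (ℕ.<-trans b<c c<k)) (τ-! a (ℕ.<-trans a<b (ℕ.<-trans b<c c<k))) (ℕ.+-monoʳ-< (suc m) τb<τa))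
        (subst₂ _<_ (τ-! c c<k) (τ-! b (ℕ.<-trans b<c c<k)) (ℕ.+-monoʳ-< (suc m) τc<τb)))

    directSum≡ : directSum m k σ τ ≡ w
    directSum≡ = !-ext _ _ (trans (length-applyUpTo (directSumEntry m σ τ) (suc m + k)) (sym length≡)) λ j j< →
      let j<n = subst (j <_) (length-applyUpTo (directSumEntry m σ τ) (suc m + k)) j< in
      entry j (DirectSum.block m k σ τ j j<n)
      where
      entry : ∀ j → DirectSum.Block m k σ τ j → directSum m k σ τ ! j ≡ w ! j
      entry j (DirectSum.left j<m e) = trans e (σ-! j j<m)
      entry j (DirectSum.middle refl e) = trans e (sym fixed)
      entry j (DirectSum.right j′ refl j′<k e) = trans e (τ-! j′ j′<k)

  directSums : ℕ → ℕ → List (List ℕ)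
  directSums m k = concatMap (λ σ → map (directSum m k σ) (avoiders k)) (avoiders m)

  fixingAvoiders : ℕ → ℕ → List (List ℕ)
  fixingAvoiders n m = filter (λ w → w ! m ℕ.≟ m) (avoiders n)

  ∈-directSums⁻ : ∀ {m k w} → w ∈ directSums m k → Avoider (suc m + k) w × w ! m ≡ m
  ∈-directSums⁻ {m} {k} w∈ with find (∈-concatMap⁻ (λ σ → map (directSum m k σ) (avoiders k)) {xs = avoiders m} w∈)
  ... | σ , σ∈ , w∈′ with ∈-map⁻ (directSum m k σ) w∈′
  ... | τ , τ∈ , refl = DirectSum.directSum-Avoider m k σ τ (∈-avoiders⁻ σ∈) (∈-avoiders⁻ τ∈)
                      , DirectSum.directSum-fixed m k σ τ

  ∈-directSums⁺ : ∀ {m k w} → Avoider (suc m + k) w → w ! m ≡ m → w ∈ directSums m k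
  ∈-directSums⁺ {m} {k} {w} w-avoids fixed = subst (_∈ directSums m k) directSum≡
    (∈-concatMap⁺ (λ σ → map (directSum m k σ) (avoiders k)) {xs = avoiders m}
      (Any.map (λ { refl → ∈-map⁺ (directSum m k σ) (∈-avoiders⁺ τ-avoids) }) (∈-avoiders⁺ σ-avoids)))
    where open SplitAtFixedPoint w-avoids fixed

  directSums-unique : ∀ m k → Unique (directSums m k)
  directSums-unique m k = Unique-concatMap _ (avoiders m) (avoiders-unique m)
    (λ σ σ∈ → Unique-map _ (avoiders k)
      (λ τ τ′ τ∈ τ′∈ same → proj₂ (directSum-injective (|·| σ∈) (|·| τ∈) (|·| σ∈) (|·| τ′∈) same))
      (avoiders-unique k))
    same-left
    where
    |·| : ∀ {l w} → w ∈ avoiders l → length w ≡ l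
    |·| w∈ = Avoider.length≡ (∈-avoiders⁻ w∈)

    same-left : ∀ σ σ′ w → σ ∈ avoiders m → σ′ ∈ avoiders m → w ∈ map (directSum m k σ) (avoiders k) →
                w ∈ map (directSum m k σ′) (avoiders k) → σ ≡ σ′
    same-left σ σ′ w σ∈ σ′∈ w∈ w∈′ with ∈-map⁻ (directSum m k σ) w∈ | ∈-map⁻ (directSum m k σ′) w∈′
    ... | τ , τ∈ , refl | τ′ , τ′∈ , same =
      proj₁ (directSum-injective (|·| σ∈) (|·| τ∈) (|·| σ′∈) (|·| τ′∈) same)

  fixingAvoiders↭directSums : ∀ m k → fixingAvoiders (suc m + k) m ↭ directSums m k
  fixingAvoiders↭directSums m k = unique-↭ (Unique.filter⁺ fixes-m? (avoiders-unique (suc m + k))) (directSums-unique m k)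
    (λ w∈ → let (w∈′ , fixed) = ∈-filter⁻ fixes-m? {xs = avoiders (suc m + k)} w∈
            in ∈-directSums⁺ (∈-avoiders⁻ w∈′) fixed)
    (λ w∈ → let (w-avoids , fixed) = ∈-directSums⁻ w∈ in ∈-filter⁺ fixes-m? (∈-avoiders⁺ w-avoids) fixed)
    where fixes-m? = λ w → w ! m ℕ.≟ m


module Recurrence where

  open import Defs
  open import Level using (0ℓ)
  open import Function using (_∘_; id)
  open import Data.Nat as ℕ using (ℕ; zero; suc; _<_; _∸_; _≡ᵇ_)
  import Data.Nat.Properties as ℕ
  open import Data.Bool using (Bool)
  open import Data.Integer using (ℤ; +_; _+_; _*_; _-_; _^_; 1ℤ)
  open import Data.Fin as Fin using (Fin; toℕ)
  open import Data.Vec using (Vec; lookup)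
  open import Data.List using (List; map; filter; length; tabulate)
  open import Relation.Nullary using (yes; no; does)
  open import Relation.Unary using (Pred; Decidable)
  open import Relation.Binary.PropositionalEquality as ≡ using (_≡_; refl; sym; trans; cong; cong₂)
  open ≡.≡-Reasoning
  open IntegerListSum
  open RangeSum
  open Avoiders
  open GeneratingTree using (#avoiders; #avoiders≡catalan)
  open GeometricSum
  open FixedPointSplitting

  a′ : ℕ → ℤ → ℤ
  a′ n x = ΣZ (map (λ w → x ^ fixedPointCount n w) (avoiders n))

  length-filter-tabulate : ∀ {B : Set} {P : Pred B 0ℓ} (P? : Decidable P) n (f : Fin n → B) (p : ℕ → Bool) →
    (∀ i → does (P? (f i)) ≡ p (toℕ i)) → length (filter P? (tabulate f)) ≡ count p n
  length-filter-tabulate P? zero f p agree = refl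
  length-filter-tabulate P? (suc n) f p agree with P? (f Fin.zero) | agree Fin.zero
  ... | yes _ | agree₀ rewrite sym agree₀ = cong suc (length-filter-tabulate P? n (f ∘ Fin.suc) (p ∘ suc) (agree ∘ Fin.suc))
  ... | no _ | agree₀ rewrite sym agree₀ = length-filter-tabulate P? n (f ∘ Fin.suc) (p ∘ suc) (agree ∘ Fin.suc)

  fixedPoints≡fixedPointCount : ∀ {n} (v : Vec (Fin n) n) → fixedPoints v ≡ fixedPointCount n (toℕs v)
  fixedPoints≡fixedPointCount {n} v = length-filter-tabulate (λ i → toℕ (lookup v i) ℕ.≟ toℕ i) n id
    (λ j → toℕs v ! j ≡ᵇ j) (λ i → cong (_≡ᵇ toℕ i) (sym (toℕs-! v i)))

  a≡a′ : ∀ n x → a n x ≡ a′ n x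
  a≡a′ n x = sym (trans (ΣZ-map (λ w → x ^ fixedPointCount n w) toℕs (S321 n))
    (ΣZ-cong (S321 n) (λ v _ → cong (x ^_) (sym (fixedPoints≡fixedPointCount v)))))

  ΣZ-fixingAvoiders : ∀ m k x →
    ΣZ (map (λ w → x ^ fixedPointsAfter m k w) (fixingAvoiders (suc m ℕ.+ k) m)) ≡ #avoiders m * a′ k x
  ΣZ-fixingAvoiders m k x = begin
    ΣZ (map F (fixingAvoiders (suc m ℕ.+ k) m))
      ≡⟨ ΣZ-↭ F (fixingAvoiders↭directSums m k) ⟩
    ΣZ (map F (directSums m k))
      ≡⟨ ΣZ-concatMap F _ (avoiders m) ⟩
    ΣZ (map (λ σ → ΣZ (map F (map (directSum m k σ) (avoiders k)))) (avoiders m))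
      ≡⟨ ΣZ-cong (avoiders m) (λ σ _ → trans (ΣZ-map F (directSum m k σ) (avoiders k))
           (ΣZ-cong (avoiders k) (λ τ _ → cong (x ^_) (fixedPointsAfter-directSum m k σ τ)))) ⟩
    ΣZ (map (λ _ → a′ k x) (avoiders m))
      ≡⟨ ΣZ-const (a′ k x) (avoiders m) ⟩
    #avoiders m * a′ k x ∎
    where F = λ w → x ^ fixedPointsAfter m k w

  ΣZ-geometric-fixedPointCount : ∀ n x →
    ΣZ (map (λ w → geometric x (fixedPointCount n w)) (avoiders n)) ≡ Σ< n (λ m → #avoiders m * a′ (n ∸ suc m) x)
  ΣZ-geometric-fixedPointCount n x = begin
    ΣZ (map (λ w → geometric x (fixedPointCount n w)) (avoiders n))
      ≡⟨ ΣZ-cong (avoiders n) (λ w _ → geometric-count x (λ j → w ! j ≡ᵇ j) n) ⟩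
    ΣZ (map (λ w → Σ< n (term w)) (avoiders n))
      ≡⟨ ΣZ-Σ< term (avoiders n) n ⟩
    Σ< n (λ m → ΣZ (map (λ w → term w m) (avoiders n)))
      ≡⟨ Σ<-cong n fixed-at ⟩
    Σ< n (λ m → #avoiders m * a′ (n ∸ suc m) x) ∎
    where
    term : List ℕ → ℕ → ℤ
    term w m = when (w ! m ≡ᵇ m) (x ^ fixedPointsAfter m (n ∸ suc m) w)
    fixed-at : ∀ m → m < n → ΣZ (map (λ w → term w m) (avoiders n)) ≡ #avoiders m * a′ (n ∸ suc m) x
    fixed-at m m<n = begin
      ΣZ (map (λ w → term w m) (avoiders n))
        ≡⟨ sym (ΣZ-filter (λ w → w ! m ℕ.≟ m) F (avoiders n)) ⟩
      ΣZ (map F (fixingAvoiders n m))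
        ≡⟨ cong (λ l → ΣZ (map F (fixingAvoiders l m))) (sym (ℕ.m+[n∸m]≡n m<n)) ⟩
      ΣZ (map F (fixingAvoiders (suc m ℕ.+ (n ∸ suc m)) m))
        ≡⟨ ΣZ-fixingAvoiders m (n ∸ suc m) x ⟩
      #avoiders m * a′ (n ∸ suc m) x ∎
      where F = λ w → x ^ fixedPointsAfter m (n ∸ suc m) w

  a′-recurrence : ∀ n x → a′ n x ≡ #avoiders n + (x - 1ℤ) * Σ< n (λ m → #avoiders m * a′ (n ∸ suc m) x)
  a′-recurrence n x = begin
    a′ n x
      ≡⟨ ΣZ-cong (avoiders n) (λ w _ → ^≡1+[x-1]*geometric x (fixedPointCount n w)) ⟩
    ΣZ (map (λ w → 1ℤ + (x - 1ℤ) * G w) (avoiders n))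
      ≡⟨ ΣZ-+ (λ _ → 1ℤ) (λ w → (x - 1ℤ) * G w) (avoiders n) ⟩
    #avoiders n + ΣZ (map (λ w → (x - 1ℤ) * G w) (avoiders n))
      ≡⟨ cong (_+_ (#avoiders n)) (sym (ΣZ-*ˡ (x - 1ℤ) G (avoiders n))) ⟩
    #avoiders n + (x - 1ℤ) * ΣZ (map G (avoiders n))
      ≡⟨ cong (λ s → #avoiders n + (x - 1ℤ) * s) (ΣZ-geometric-fixedPointCount n x) ⟩
    #avoiders n + (x - 1ℤ) * Σ< n (λ m → #avoiders m * a′ (n ∸ suc m) x) ∎
    where G = λ w → geometric x (fixedPointCount n w)

  a-recurrence : ∀ n x → a n x ≡ + catalan n + (x - 1ℤ) * Σ< n (λ m → + catalan m * a (n ∸ suc m) x)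
  a-recurrence n x = begin
    a n x
      ≡⟨ a≡a′ n x ⟩
    a′ n x
      ≡⟨ a′-recurrence n x ⟩
    #avoiders n + (x - 1ℤ) * Σ< n (λ m → #avoiders m * a′ (n ∸ suc m) x)
      ≡⟨ cong₂ (λ c s → c + (x - 1ℤ) * s) (#avoiders≡catalan n)
           (Σ<-cong n (λ m _ → cong₂ _*_ (#avoiders≡catalan m) (sym (a≡a′ (n ∸ suc m) x)))) ⟩
    + catalan n + (x - 1ℤ) * Σ< n (λ m → + catalan m * a (n ∸ suc m) x) ∎


open import Defs
open import Data.Nat using (ℕ; suc; _∸_; _<_; _≤_)
open import Data.Integer using (ℤ; _*_; _-_; _^_; +_; 0ℤ; 1ℤ)
open import Data.List using (map; upTo)
open import Relation.Binary.PropositionalEquality using (_≡_)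


module CoefficientRecurrence
  (b : ℕ → ℕ → ℤ)
  (b-vanishes : ∀ n k → n < k → b n k ≡ 0ℤ)
  (expansion : ∀ n (x : ℤ) → a n x ≡ ΣZ (map (λ k → b n k * (x - 1ℤ) ^ k) (upTo (suc n))))
  where

  open import Data.Nat as ℕ using (zero; suc; _<_; _≤_; _∸_)
  import Data.Nat.Properties as ℕ
  open import Data.Integer using (_+_)
  open import Data.Integer.Properties using (*-zeroˡ; *-zeroʳ; +-identityʳ)
  open import Data.Integer.Tactic.RingSolver using (solve-∀)
  open import Relation.Nullary using (yes; no)
  open import Relation.Binary.PropositionalEquality as ≡ using (sym; trans; cong; cong₂)
  open ≡.≡-Reasoning
  open RangeSum
  open PolynomialCoefficients using (horner; coefficients-unique)
  open Recurrence using (a-recurrence)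

  B : ℕ → ℤ → ℤ
  B n y = Σ< (suc n) (λ k → b n k * y ^ k)

  D : ℕ → ℕ → ℤ
  D n i = Σ< n (λ j → + catalan j * b (n ∸ suc j) i)

  a-shifted : ∀ n y → a n (y + 1ℤ) ≡ B n y
  a-shifted n y = begin
    a n (y + 1ℤ)
      ≡⟨ expansion n (y + 1ℤ) ⟩
    ΣZ (map (λ k → b n k * ((y + 1ℤ) - 1ℤ) ^ k) (upTo (suc n)))
      ≡⟨ ΣZ-upTo _ (suc n) ⟩
    Σ< (suc n) (λ k → b n k * ((y + 1ℤ) - 1ℤ) ^ k)
      ≡⟨ Σ<-cong (suc n) (λ k _ → cong (λ z → b n k * z ^ k) (cancel y)) ⟩
    B n y ∎
    where
    cancel : ∀ y → (y + 1ℤ) - 1ℤ ≡ y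
    cancel = solve-∀

  b-constant : ∀ n → b n 0 ≡ + catalan n
  b-constant n = begin
    b n 0
      ≡⟨ sym (+-identityʳ (b n 0)) ⟩
    b n 0 + 0ℤ
      ≡⟨ cong (_+_ (b n 0)) (sym (*-zeroˡ (Σ< n (λ k → b n (suc k) * 0ℤ ^ k)))) ⟩
    b n 0 + 0ℤ * Σ< n (λ k → b n (suc k) * 0ℤ ^ k)
      ≡⟨ sym (horner n (b n) 0ℤ) ⟩
    B n 0ℤ
      ≡⟨ sym (a-shifted n 0ℤ) ⟩
    a n 1ℤ
      ≡⟨ a-recurrence n 1ℤ ⟩
    + catalan n + 0ℤ * Σ< n (λ m → + catalan m * a (n ∸ suc m) 1ℤ)
      ≡⟨ cong (_+_ (+ catalan n)) (*-zeroˡ (Σ< n (λ m → + catalan m * a (n ∸ suc m) 1ℤ))) ⟩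
    + catalan n + 0ℤ
      ≡⟨ +-identityʳ _ ⟩
    + catalan n ∎

  B-padded : ∀ n j y → j < n → B (n ∸ suc j) y ≡ Σ< n (λ k → b (n ∸ suc j) k * y ^ k)
  B-padded n j y j<n = begin
    B m y                                      ≡⟨ sym (Σ<-trailingZeros m j _ beyond-degree) ⟩
    Σ< (suc m ℕ.+ j) (λ k → b m k * y ^ k)     ≡⟨ cong (λ l → Σ< l (λ k → b m k * y ^ k)) [1+m]+j≡n ⟩
    Σ< n (λ k → b m k * y ^ k)                 ∎
    where
    m = n ∸ suc j
    beyond-degree : ∀ k → m < k → b m k * y ^ k ≡ 0ℤ
    beyond-degree k m<k = trans (cong (_* y ^ k) (b-vanishes m k m<k)) (*-zeroˡ (y ^ k))
    [1+m]+j≡n : suc m ℕ.+ j ≡ n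
    [1+m]+j≡n = trans (cong (ℕ._+ j) (sym (ℕ.+-∸-assoc 1 j<n))) (ℕ.m∸n+n≡m (ℕ.<⇒≤ j<n))

  B-recurrence : ∀ n y → B n y ≡ b n 0 + y * Σ< n (λ i → D n i * y ^ i)
  B-recurrence n y = begin
    B n y
      ≡⟨ sym (a-shifted n y) ⟩
    a n (y + 1ℤ)
      ≡⟨ a-recurrence n (y + 1ℤ) ⟩
    + catalan n + ((y + 1ℤ) - 1ℤ) * Σ< n (λ j → + catalan j * a (n ∸ suc j) (y + 1ℤ))
      ≡⟨ cong₂ (λ c z → c + z * Σ< n (λ j → + catalan j * a (n ∸ suc j) (y + 1ℤ))) (sym (b-constant n)) (cancel y) ⟩
    b n 0 + y * Σ< n (λ j → + catalan j * a (n ∸ suc j) (y + 1ℤ))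
      ≡⟨ cong (λ s → b n 0 + y * s) (Σ<-cong n (λ j j<n → cong (λ z → + catalan j * z)
           (trans (a-shifted (n ∸ suc j) y) (B-padded n j y j<n)))) ⟩
    b n 0 + y * Σ< n (λ j → + catalan j * Σ< n (λ i → b (n ∸ suc j) i * y ^ i))
      ≡⟨ cong (λ s → b n 0 + y * s) (Σ<-collect n n (λ j → + catalan j) (λ j → b (n ∸ suc j)) (y ^_)) ⟩
    b n 0 + y * Σ< n (λ i → D n i * y ^ i) ∎
    where cancel : ∀ y → (y + 1ℤ) - 1ℤ ≡ y
          cancel = solve-∀

  b-recurrence-below : ∀ n i → i < n → b n (suc i) ≡ D n i
  b-recurrence-below n i i<n = coefficients-unique (suc n) (b n) E same-polynomial (suc i) (ℕ.s≤s i<n)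
    where
    E : ℕ → ℤ
    E zero = b n 0
    E (suc i) = D n i
    same-polynomial : ∀ y → B n y ≡ Σ< (suc n) (λ k → E k * y ^ k)
    same-polynomial y = trans (B-recurrence n y) (sym (horner n E y))

  D-vanishes : ∀ n i → n ≤ i → D n i ≡ 0ℤ
  D-vanishes n i n≤i = Σ<-zero n _ λ j j<n →
    trans (cong (+ catalan j *_) (b-vanishes (n ∸ suc j) i (ℕ.<-≤-trans (ℕ.∸-monoʳ-< ℕ.z<s j<n) n≤i)))
          (*-zeroʳ (+ catalan j))

  b-recurrence : ∀ n i → b n (suc i) ≡ D n i
  b-recurrence n i with i ℕ.<? n
  ... | yes i<n = b-recurrence-below n i i<n
  ... | no i≮n = trans (b-vanishes n (suc i) (ℕ.s≤s (ℕ.≮⇒≥ i≮n))) (sym (D-vanishes n i (ℕ.≮⇒≥ i≮n)))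

lemma4p3 : (b : ℕ → ℕ → ℤ)
    → (∀ n k → n < k → b n k ≡ 0ℤ)
    → (∀ n (x : ℤ) → a n x ≡ ΣZ (map (λ k → b n k * (x - 1ℤ) ^ k) (upTo (suc n))))
    → ∀ n k → 1 ≤ n → 1 ≤ k
    → b n k ≡ ΣZ (map (λ j → + catalan j * b (n ∸ suc j) (k ∸ 1)) (upTo n))
lemma4p3 b b-vanishes expansion n (suc k) _ _ = begin
  b n (suc k)                                                ≡⟨ b-recurrence n k ⟩
  D n k                                                      ≡⟨ sym (ΣZ-upTo _ n) ⟩
  ΣZ (map (λ j → + catalan j * b (n ∸ suc j) k) (upTo n))    ∎
  where
  open import Relation.Binary.PropositionalEquality as ≡ using (sym)
  open ≡.≡-Reasoning
  open RangeSum using (ΣZ-upTo)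
  open CoefficientRecurrence b b-vanishes expansion using (D; b-recurrence)
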